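{- Let $\mathbb K$ be a computable zero-sum free commutative semiring and let $S:\mathrm{NW}(\Delta)\to\mathbb K$ be a regular nested word series (given by a weighted nested word automaton). It is decidable whether $(S,nw)=0$ for all $nw\in\mathrm{NW}(\Delta)$.
   Context: Zero-sum free: $a+b=0$ implies $a=b=0$. Computable: elements finitely representable, operations and equality computable. $\mathbb K$ has $0\ne1$. Nested words: a nesting relation of width $n$ is a binary relation $\nu$ on $[n]$ with $\nu(i,j)\Rightarrow i<j$; $\nu(i,j),\nu(i,j')\Rightarrow j=j'$; $\nu(i,j),\nu(i',j)\Rightarrow i=i'$; $\nu(i,j),\nu(i',j'),i<i'\Rightarrow j<i'$ or $j'<j$. A nested word is $(a_1\dots a_n,\nu)$, $n\ge1$, $a_i$ in finite alphabet $\Delta$; $(i,j)\in\nu$: $i$ call, $j$ return; others internal. WNWA: $\mathcal A=(Q,\iota,(\delta_{call},\delta_{int},\delta_{ret}),\kappa)$, $Q$ finite, $\delta_{call},\delta_{int}:Q\times\Delta\times Q\to\mathbb K$, $\delta_{ret}:Q\times Q\times\Delta\times Q\to\mathbb K$, $\iota,\kappa:Q\to\mathbb K$; run on $(a_1\dots a_n,\nu)$: $(q_0..q_n)$ with weight $\prod_j$ of $\delta_{call}(q_{j-1},a_j,q_j)$ ($j$ call), $\delta_{int}(q_{j-1},a_j,q_j)$ ($j$ internal), $\delta_{ret}(q_{j-1},q_{i-1},a_j,q_j)$ ($(i,j)\in\nu$); $(\|\mathcal A\|,nw)=\sum_{q_0,q_n}\iota(q_0)\sum_{\text{runs }q_0\to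 q_n}\mathrm{weight}\cdot\kappa(q_n)$. Regular: $=\|\mathcal A\|$ for some WNWA. -}

module Defs where

open import Level using (Level; _⊔_)
open import Data.Nat using (ℕ; zero; suc; _≤_)
open import Data.Fin using (Fin; zero; suc; inject₁) renaming (_<_ to _<ᶠ_)
open import Data.Bool using (Bool; true; false; if_then_else_)
open import Data.Maybe using (Maybe; just; nothing)
open import Data.Sum using (_⊎_)
open import Data.Product using (_×_)
open import Relation.Binary.PropositionalEquality using (_≡_)
open import Algebra.Bundles using (CommutativeSemiring)

ZeroSumFree : ∀ {c ℓ} → CommutativeSemiring c ℓ → Set (c ⊔ ℓ)
ZeroSumFree K = ∀ a b → a + b ≈ 0# → (a ≈ 0#) × (b ≈ 0#)
  where open CommutativeSemiring K

-- Positions [n] = {1..n} are represented by Fin n (0-based).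

record IsNesting {n : ℕ} (ν : Fin n → Fin n → Bool) : Set where
  field
    forward   : ∀ i j → ν i j ≡ true → i <ᶠ j
    uniqueRet : ∀ i j j′ → ν i j ≡ true → ν i j′ ≡ true → j ≡ j′
    uniqueCall : ∀ i i′ j → ν i j ≡ true → ν i′ j ≡ true → i ≡ i′
    noCross   : ∀ i j i′ j′ → ν i j ≡ true → ν i′ j′ ≡ true → i <ᶠ i′ →
                (j <ᶠ i′) ⊎ (j′ <ᶠ j)

record NestedWord (d : ℕ) : Set where
  field
    n       : ℕ
    nonempty : 1 ≤ n
    letter  : Fin n → Fin d
    ν       : Fin n → Fin n → Bool
    nesting : IsNesting ν

record WNWA {c ℓ} (K : CommutativeSemiring c ℓ) (d k : ℕ) : Set c where
  open CommutativeSemiring K using (Carrier)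
  field
    ι     : Fin k → Carrier
    δcall : Fin k → Fin d → Fin k → Carrier
    δint  : Fin k → Fin d → Fin k → Carrier
    δret  : Fin k → Fin k → Fin d → Fin k → Carrier
    κ     : Fin k → Carrier

firstTrue : ∀ {n} → (Fin n → Bool) → Maybe (Fin n)
firstTrue {zero} p = nothing
firstTrue {suc n} p with p zero
... | true = just zero
... | false with firstTrue (λ i → p (suc i))
...   | just i = just (suc i)
...   | nothing = nothing

module _ {c ℓ} (K : CommutativeSemiring c ℓ) where
  open CommutativeSemiring K using (Carrier; _+_; _*_; 0#; 1#)

  ∑ : ∀ {n} → (Fin n → Carrier) → Carrier
  ∑ {zero} f = 0#
  ∑ {suc n} f = f zero + ∑ (λ i → f (suc i))

  ∏ : ∀ {n} → (Fin n → Carrier) → Carrier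
  ∏ {zero} f = 1#
  ∏ {suc n} f = f zero * ∏ (λ i → f (suc i))

  ∑seq : ∀ {k} (m : ℕ) → ((Fin m → Fin k) → Carrier) → Carrier
  ∑seq zero F = F (λ ())
  ∑seq (suc m) F = ∑ (λ q → ∑seq m (λ r → F (λ { zero → q ; (suc i) → r i })))

  module _ {d k : ℕ} (A : WNWA K d k) (w : NestedWord d) where
    open WNWA A
    open NestedWord w

    stepWeight : (Fin (suc n) → Fin k) → Fin n → Carrier
    stepWeight q j with firstTrue (λ i → ν i j)
    ... | just i  = δret (q (inject₁ j)) (q (inject₁ i)) (letter j) (q (suc j))
    ... | nothing with firstTrue (λ j′ → ν j j′)
    ...   | just _  = δcall (q (inject₁ j)) (letter j) (q (suc j))
    ...   | nothing = δint (q (inject₁ j)) (letter j) (q (suc j))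

    runWeight : (Fin (suc n) → Fin k) → Carrier
    runWeight q = ∏ (stepWeight q)

  ⟦_⟧ : ∀ {d k} → WNWA K d k → NestedWord d → Carrier
  ⟦ A ⟧ w = ∑seq (suc n) (λ q → ι (q zero) * runWeight A w q * κ (q (Data.Fin.fromℕ n)))
    where open WNWA A
          open NestedWord w

-- A run of A on a nested word is described by a run tree, whose nodes are
-- internal transitions and call blocks (call, subtree for the enclosed subword,
-- matching return, subtree for the rest); the run weight is the product of the
-- transition weights of the tree (`FinRun.runTree` and `runWeight-wordOf` give
-- both directions).  By zero-sum freeness ‖A‖ vanishes iff every run term
-- ι(q₀)·weight·κ(qₙ) does.  In a commutative semiring the weight of a subtree
-- divides that of the tree, so replacing a tree by an innermost subtree with the
-- same end states keeps a nonzero term nonzero; this `pump`s every tree down to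
-- height k², leaving finitely many `candidates` whose terms can be tested.

module Submission where

open import Defs
open import Level using (_⊔_)
open import Data.Nat using (ℕ)
open import Relation.Nullary using (Dec; ¬_)
open import Relation.Binary using (Decidable)
open import Algebra.Bundles using (CommutativeSemiring)

open import Data.Nat as ℕ using (zero; suc; _+_; _∸_; _≤_; _<_; _≡ᵇ_; z≤n; s≤s)
import Data.Nat.Properties as ℕP
import Relation.Binary.Reasoning.Setoid
open import Data.Fin as F using (Fin; toℕ)
import Data.Fin.Properties as FP
open import Data.Bool using (Bool; true; false) renaming (_≟_ to _≟ᵇ_)
open import Data.Maybe using (just; nothing)
open import Data.Bool.Properties using (¬-not; T-≡)
open import Data.Empty using (⊥; ⊥-elim)
open import Data.Unit using (⊤; tt)
open import Data.Sum using (_⊎_; inj₁; inj₂)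
open import Data.Product using (Σ; _×_; _,_; proj₁; proj₂)
open import Data.List using (List; []; _∷_; _++_; length; filter; map; concatMap; allFin; cartesianProduct)
open import Data.List.Relation.Unary.Any using (Any; here; any?; satisfied)
open import Data.List.Membership.Propositional using (_∈_; lose)
open import Data.List.Membership.Propositional.Properties
  using (∈-++⁺ˡ; ∈-++⁺ʳ; ∈-allFin; ∈-cartesianProduct⁺; ∈-map⁺; ∈-concatMap⁺; ∈-filter⁺)
open import Data.List.Properties using (filter-notAll)
open import Data.Product.Properties using (≡-dec)
open import Relation.Nullary using (yes; no; ¬?)
open import Relation.Nullary.Decidable using (map′; decidable-stable; _×-dec_)
open import Function using (Equivalence; _∘_)
open import Relation.Binary using (tri<; tri≈; tri>)
open import Relation.Binary.PropositionalEquality as Eq using (_≡_; refl; _≢_)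

extend : ∀ {a} {X : Set a} {n} → (Fin n → X) → X → ℕ → X
extend {n = zero}  f x m       = x
extend {n = suc n} f x zero    = f F.zero
extend {n = suc n} f x (suc m) = extend (λ i → f (F.suc i)) x m

extend-toℕ : ∀ {a} {X : Set a} {n} (f : Fin n → X) x i → extend f x (toℕ i) ≡ f i
extend-toℕ f x F.zero    = refl
extend-toℕ f x (F.suc i) = extend-toℕ (λ i → f (F.suc i)) x i

extend-inv : ∀ {a} {X : Set a} {n} (f : Fin n → X) x m {y} → extend f x m ≡ y → y ≢ x →
             Σ (Fin n) λ i → toℕ i ≡ m × f i ≡ y
extend-inv {n = zero}  f x m       e ne = ⊥-elim (ne (Eq.sym e))
extend-inv {n = suc n} f x zero    e ne = F.zero , refl , e
extend-inv {n = suc n} f x (suc m) e ne with extend-inv (λ i → f (F.suc i)) x m e ne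
... | i , p , e′ = F.suc i , Eq.cong suc p , e′

extend-agree : ∀ {a} {X : Set a} {n} (f : Fin n → X) x (G : ℕ → X) →
               (∀ i → f i ≡ G (toℕ i)) → ∀ m → m < n → extend f x m ≡ G m
extend-agree f x G h m m<n =
  Eq.trans (Eq.cong (extend f x) (Eq.sym (FP.toℕ-fromℕ< m<n)))
    (Eq.trans (extend-toℕ f x (F.fromℕ< m<n)) (Eq.trans (h _) (Eq.cong G (FP.toℕ-fromℕ< m<n))))

-- Working
-- with ℕ-positions lets us cut words into pieces and glue them together.
record IsNestingℕ (n : ℕ) (N : ℕ → ℕ → Bool) : Set where
  field
    range      : ∀ i j → N i j ≡ true → i < j × j < n
    uniqueRet  : ∀ i j j′ → N i j ≡ true → N i j′ ≡ true → j ≡ j′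
    uniqueCall : ∀ i i′ j → N i j ≡ true → N i′ j ≡ true → i ≡ i′
    noCross    : ∀ i j i′ j′ → N i j ≡ true → N i′ j′ ≡ true → i < i′ → (j < i′) ⊎ (j′ < j)

true≢false : true ≢ false
true≢false ()

extend₂ : ∀ {n} → (Fin n → Fin n → Bool) → ℕ → ℕ → Bool
extend₂ ν m m′ = extend (λ i → extend (ν i) false m′) false m

extend₂-toℕ : ∀ {n} (ν : Fin n → Fin n → Bool) i j → extend₂ ν (toℕ i) (toℕ j) ≡ ν i j
extend₂-toℕ ν i j = Eq.trans (extend-toℕ _ false i) (extend-toℕ (ν i) false j)

extend₂-inv : ∀ {n} (ν : Fin n → Fin n → Bool) m m′ → extend₂ ν m m′ ≡ true →
              Σ (Fin n) λ i → Σ (Fin n) λ j → toℕ i ≡ m × toℕ j ≡ m′ × ν i j ≡ true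
extend₂-inv ν m m′ e with extend-inv _ false m e true≢false
... | i , p , e′ with extend-inv (ν i) false m′ e′ true≢false
...   | j , p′ , e″ = i , j , p , p′ , e″

isNesting-toFin : ∀ {n N} → IsNestingℕ n N → IsNesting {n} (λ i j → N (toℕ i) (toℕ j))
isNesting-toFin nn = record
  { forward    = λ i j e → proj₁ (range _ _ e)
  ; uniqueRet  = λ i j j′ e₁ e₂ → FP.toℕ-injective (uniqueRet _ _ _ e₁ e₂)
  ; uniqueCall = λ i i′ j e₁ e₂ → FP.toℕ-injective (uniqueCall _ _ _ e₁ e₂)
  ; noCross    = λ i j i′ j′ e₁ e₂ lt → noCross _ _ _ _ e₁ e₂ lt }
  where open IsNestingℕ nn

extend₂-toFin : ∀ {n N} → IsNestingℕ n N → ∀ m m′ → extend₂ {n} (λ i j → N (toℕ i) (toℕ j)) m m′ ≡ N m m′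
extend₂-toFin {n} {N} nest m m′ with N m m′ in e
... | true  = Eq.trans (extend-agree _ false (λ m → N m m′) (λ i → extend-agree _ false (N (toℕ i)) (λ j → refl) m′ m′<n) m m<n) e
  where
    m′<n = proj₂ (IsNestingℕ.range nest m m′ e)
    m<n  = ℕP.<-trans (proj₁ (IsNestingℕ.range nest m m′ e)) m′<n
... | false = ¬-not λ e′ → edge (extend₂-inv _ m m′ e′)
  where
    edge : (Σ (Fin n) λ i → Σ (Fin n) λ j → toℕ i ≡ m × toℕ j ≡ m′ × N (toℕ i) (toℕ j) ≡ true) → ⊥
    edge (i , j , refl , refl , v) = true≢false (Eq.trans (Eq.sym v) e)

isNesting-fromFin : ∀ {n} {ν : Fin n → Fin n → Bool} → IsNesting ν → IsNestingℕ n (extend₂ ν)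
isNesting-fromFin {n} {ν} nest = record
  { range = range′ ; uniqueRet = uniqueRet′ ; uniqueCall = uniqueCall′ ; noCross = noCross′ }
  where
    open IsNesting nest
    fromCall : ∀ (i : Fin n) m′ → extend₂ ν (toℕ i) m′ ≡ true → Σ (Fin n) λ j → toℕ j ≡ m′ × ν i j ≡ true
    fromCall i m′ e with extend₂-inv ν _ _ e
    ... | i′ , j , p , p′ , v with FP.toℕ-injective p
    ...   | refl = j , p′ , v
    fromRet : ∀ m (j : Fin n) → extend₂ ν m (toℕ j) ≡ true → Σ (Fin n) λ i → toℕ i ≡ m × ν i j ≡ true
    fromRet m j e with extend₂-inv ν _ _ e
    ... | i , j′ , p , p′ , v with FP.toℕ-injective p′
    ...   | refl = i , p , v
    range′ : ∀ i j → extend₂ ν i j ≡ true → i < j × j < n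
    range′ i j e with extend₂-inv ν i j e
    ... | i′ , j′ , refl , refl , v = forward i′ j′ v , FP.toℕ<n j′
    uniqueRet′ : ∀ i j j′ → extend₂ ν i j ≡ true → extend₂ ν i j′ ≡ true → j ≡ j′
    uniqueRet′ i j j′ e₁ e₂ with extend₂-inv ν i j e₁
    ... | a , b , refl , refl , v with fromCall a j′ e₂
    ...   | b′ , refl , v′ = Eq.cong toℕ (uniqueRet a b b′ v v′)
    uniqueCall′ : ∀ i i′ j → extend₂ ν i j ≡ true → extend₂ ν i′ j ≡ true → i ≡ i′
    uniqueCall′ i i′ j e₁ e₂ with extend₂-inv ν i j e₁
    ... | a , b , refl , refl , v with fromRet i′ b e₂
    ...   | a′ , refl , v′ = Eq.cong toℕ (uniqueCall a a′ b v v′)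
    noCross′ : ∀ i j i′ j′ → extend₂ ν i j ≡ true → extend₂ ν i′ j′ ≡ true → i < i′ → (j < i′) ⊎ (j′ < j)
    noCross′ i j i′ j′ e₁ e₂ lt with extend₂-inv ν i j e₁ | extend₂-inv ν i′ j′ e₂
    ... | a , b , refl , refl , v | a′ , b′ , refl , refl , v′ = noCross a b a′ b′ v v′ lt

glue : ∀ {a} {X : Set a} → ℕ → (ℕ → X) → (ℕ → X) → ℕ → X
glue zero    f g m       = g m
glue (suc s) f g zero    = f zero
glue (suc s) f g (suc m) = glue s (λ i → f (suc i)) g m

glue-left : ∀ {a} {X : Set a} s (f g : ℕ → X) m → m < s → glue s f g m ≡ f m
glue-left (suc s) f g zero    h = refl
glue-left (suc s) f g (suc m) h = glue-left s (λ i → f (suc i)) g m (ℕP.≤-pred h)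

glue-right : ∀ {a} {X : Set a} s (f g : ℕ → X) m → glue s f g (s + m) ≡ g m
glue-right zero    f g m = refl
glue-right (suc s) f g m = glue-right s (λ i → f (suc i)) g m

glue-right₀ : ∀ {a} {X : Set a} s (f g : ℕ → X) → glue s f g s ≡ g 0
glue-right₀ s f g = Eq.trans (Eq.cong (glue s f g) (Eq.sym (ℕP.+-identityʳ s))) (glue-right s f g 0)

split : ∀ s m → (m < s) ⊎ Σ ℕ λ u → m ≡ s + u
split zero    m       = inj₂ (m , refl)
split (suc s) zero    = inj₁ (s≤s z≤n)
split (suc s) (suc m) with split s m
... | inj₁ h       = inj₁ (s≤s h)
... | inj₂ (u , e) = inj₂ (u , Eq.cong suc e)

blockDiag : ℕ → (ℕ → ℕ → Bool) → (ℕ → ℕ → Bool) → ℕ → ℕ → Bool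
blockDiag s N₁ N₂ i j =
  glue s (λ i′ → glue s (N₁ i′) (λ _ → false) j) (λ i′ → glue s (λ _ → false) (N₂ i′) j) i

blockDiag-ll : ∀ s N₁ N₂ i j → i < s → j < s → blockDiag s N₁ N₂ i j ≡ N₁ i j
blockDiag-ll s N₁ N₂ i j hi hj =
  Eq.trans (glue-left s _ _ i hi) (glue-left s (N₁ i) _ j hj)

blockDiag-rr : ∀ s N₁ N₂ i j → blockDiag s N₁ N₂ (s + i) (s + j) ≡ N₂ i j
blockDiag-rr s N₁ N₂ i j = Eq.trans (glue-right s _ _ i) (glue-right s _ (N₂ i) j)

blockDiag-lr : ∀ s N₁ N₂ i j → i < s → blockDiag s N₁ N₂ i (s + j) ≡ false
blockDiag-lr s N₁ N₂ i j hi = Eq.trans (glue-left s _ _ i hi) (glue-right s (N₁ i) _ j)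

blockDiag-rl : ∀ s N₁ N₂ i j → j < s → blockDiag s N₁ N₂ (s + i) j ≡ false
blockDiag-rl s N₁ N₂ i j hj = Eq.trans (glue-right s _ _ i) (glue-left s _ (N₂ i) j hj)

shiftRel : (ℕ → ℕ → Bool) → ℕ → ℕ → Bool
shiftRel N (suc i) (suc j) = N i j
shiftRel N _       _       = false

shiftRel-nesting : ∀ {n N} → IsNestingℕ n N → IsNestingℕ (suc n) (shiftRel N)
shiftRel-nesting {n} {N} nn = record
  { range = range′ ; uniqueRet = uniqueRet′ ; uniqueCall = uniqueCall′ ; noCross = noCross′ }
  where
    open IsNestingℕ nn
    range′ : ∀ i j → shiftRel N i j ≡ true → i < j × j < suc n
    range′ (suc i) (suc j) e = s≤s (proj₁ (range i j e)) , s≤s (proj₂ (range i j e))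
    uniqueRet′ : ∀ i j j′ → shiftRel N i j ≡ true → shiftRel N i j′ ≡ true → j ≡ j′
    uniqueRet′ (suc i) (suc j) (suc j′) e₁ e₂ = Eq.cong suc (uniqueRet i j j′ e₁ e₂)
    uniqueCall′ : ∀ i i′ j → shiftRel N i j ≡ true → shiftRel N i′ j ≡ true → i ≡ i′
    uniqueCall′ (suc i) (suc i′) (suc j) e₁ e₂ = Eq.cong suc (uniqueCall i i′ j e₁ e₂)
    noCross′ : ∀ i j i′ j′ → shiftRel N i j ≡ true → shiftRel N i′ j′ ≡ true → i < i′ → (j < i′) ⊎ (j′ < j)
    noCross′ (suc i) (suc j) (suc i′) (suc j′) e₁ e₂ lt with noCross i j i′ j′ e₁ e₂ (ℕP.≤-pred lt)
    ... | inj₁ x = inj₁ (s≤s x)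
    ... | inj₂ y = inj₂ (s≤s y)

≡ᵇ-refl : ∀ m → (m ≡ᵇ m) ≡ true
≡ᵇ-refl m = Equivalence.to T-≡ (ℕP.≡⇒≡ᵇ m m refl)

≡ᵇ-sound : ∀ m n → (m ≡ᵇ n) ≡ true → m ≡ n
≡ᵇ-sound m n e = ℕP.≡ᵇ⇒≡ m n (Equivalence.from T-≡ e)

-- The nesting relation of a word  a u b v  in which the call a at position 0
-- is matched by the return b at position s + 1, u (of length s) has nesting
-- relation N₁ and v has nesting relation N₂.
callBlock : ℕ → (ℕ → ℕ → Bool) → (ℕ → ℕ → Bool) → ℕ → ℕ → Bool
callBlock s N₁ N₂ zero    zero    = false
callBlock s N₁ N₂ zero    (suc j) = s ≡ᵇ j
callBlock s N₁ N₂ (suc i) zero    = false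
callBlock s N₁ N₂ (suc i) (suc j) = blockDiag s N₁ (shiftRel N₂) i j

data BlockPos (s : ℕ) : ℕ → Set where
  callPos  : BlockPos s 0
  innerPos : ∀ i → i < s → BlockPos s (suc i)
  retPos   : BlockPos s (suc (s + 0))
  outerPos : ∀ j → BlockPos s (suc (s + suc j))

blockPos : ∀ s m → BlockPos s m
blockPos s zero = callPos
blockPos s (suc m) with split s m
... | inj₁ h              = innerPos m h
... | inj₂ (zero , refl)  = retPos
... | inj₂ (suc j , refl) = outerPos j

data BlockEdge (s : ℕ) (N₁ N₂ : ℕ → ℕ → Bool) (i j : ℕ) : Set where
  outerEdge : i ≡ 0 → j ≡ suc (s + 0) → BlockEdge s N₁ N₂ i j
  leftEdge  : ∀ a b → i ≡ suc a → j ≡ suc b → a < s → b < s → N₁ a b ≡ true → BlockEdge s N₁ N₂ i j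
  rightEdge : ∀ a b → i ≡ suc (s + suc a) → j ≡ suc (s + suc b) → N₂ a b ≡ true → BlockEdge s N₁ N₂ i j

below-offset : ∀ {s a m} → a < s → a ≢ s + m
below-offset {s} {a} {m} h e = ℕP.<⇒≱ h (Eq.subst (s ≤_) (Eq.sym e) (ℕP.m≤m+n s m))

offset-above : ∀ s m → s < s + suc m
offset-above s m = ℕP.m<m+n s (s≤s z≤n)

false≡true-elim : ∀ {a} {X : Set a} → false ≡ true → X
false≡true-elim ()

callBlock-edge : ∀ s N₁ N₂ i j → callBlock s N₁ N₂ i j ≡ true → BlockEdge s N₁ N₂ i j
callBlock-edge s N₁ N₂ i j e with blockPos s i | blockPos s j
... | callPos      | callPos       = false≡true-elim e
... | callPos      | innerPos b h  = ⊥-elim (ℕP.<-irrefl (Eq.sym (≡ᵇ-sound s b e)) h)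
... | callPos      | retPos        = outerEdge refl refl
... | callPos      | outerPos b    = ⊥-elim (ℕP.<-irrefl (≡ᵇ-sound s (s + suc b) e) (offset-above s b))
... | innerPos a h | callPos       = false≡true-elim e
... | innerPos a h | innerPos b h′ = leftEdge a b refl refl h h′ (Eq.trans (Eq.sym (blockDiag-ll s N₁ (shiftRel N₂) a b h h′)) e)
... | innerPos a h | retPos        = false≡true-elim (Eq.trans (Eq.sym (blockDiag-lr s N₁ (shiftRel N₂) a 0 h)) e)
... | innerPos a h | outerPos b    = false≡true-elim (Eq.trans (Eq.sym (blockDiag-lr s N₁ (shiftRel N₂) a (suc b) h)) e)
... | retPos       | callPos       = false≡true-elim e
... | retPos       | innerPos b h′ = false≡true-elim (Eq.trans (Eq.sym (blockDiag-rl s N₁ (shiftRel N₂) 0 b h′)) e)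
... | retPos       | retPos        = false≡true-elim (Eq.trans (Eq.sym (blockDiag-rr s N₁ (shiftRel N₂) 0 0)) e)
... | retPos       | outerPos b    = false≡true-elim (Eq.trans (Eq.sym (blockDiag-rr s N₁ (shiftRel N₂) 0 (suc b))) e)
... | outerPos a   | callPos       = false≡true-elim e
... | outerPos a   | innerPos b h′ = false≡true-elim (Eq.trans (Eq.sym (blockDiag-rl s N₁ (shiftRel N₂) (suc a) b h′)) e)
... | outerPos a   | retPos        = false≡true-elim (Eq.trans (Eq.sym (blockDiag-rr s N₁ (shiftRel N₂) (suc a) 0)) e)
... | outerPos a   | outerPos b    = rightEdge a b refl refl (Eq.trans (Eq.sym (blockDiag-rr s N₁ (shiftRel N₂) (suc a) (suc b))) e)

offset-injective : ∀ s {a b} → suc (s + suc a) ≡ suc (s + suc b) → a ≡ b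
offset-injective s e = ℕP.suc-injective (ℕP.+-cancelˡ-≡ s _ _ (ℕP.suc-injective e))

callBlock-nesting : ∀ {s s₂ N₁ N₂} → IsNestingℕ s N₁ → IsNestingℕ s₂ N₂ →
                    IsNestingℕ (suc (s + suc s₂)) (callBlock s N₁ N₂)
callBlock-nesting {s} {s₂} {N₁} {N₂} n₁ n₂ = record
  { range = range′ ; uniqueRet = uniqueRet′ ; uniqueCall = uniqueCall′ ; noCross = noCross′ }
  where
    module M₁ = IsNestingℕ n₁
    module M₂ = IsNestingℕ n₂
    edge = callBlock-edge s N₁ N₂
    range′ : ∀ i j → callBlock s N₁ N₂ i j ≡ true → i < j × j < suc (s + suc s₂)
    range′ i j e with edge i j e
    ... | outerEdge refl refl = s≤s z≤n , s≤s (ℕP.+-monoʳ-< s (s≤s z≤n))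
    ... | leftEdge a b refl refl ha hb v = s≤s (proj₁ (M₁.range a b v)) , s≤s (ℕP.<-≤-trans hb (ℕP.m≤m+n s _))
    ... | rightEdge a b refl refl v =
      s≤s (ℕP.+-monoʳ-< s (s≤s (proj₁ (M₂.range a b v)))) , s≤s (ℕP.+-monoʳ-< s (s≤s (proj₂ (M₂.range a b v))))
    uniqueRet′ : ∀ i j j′ → callBlock s N₁ N₂ i j ≡ true → callBlock s N₁ N₂ i j′ ≡ true → j ≡ j′
    uniqueRet′ i j j′ e₁ e₂ with edge i j e₁ | edge i j′ e₂
    ... | outerEdge _ r₂ | outerEdge _ r₂′ = Eq.trans r₂ (Eq.sym r₂′)
    ... | outerEdge refl _ | leftEdge a b () _ _ _ _
    ... | outerEdge refl _ | rightEdge a b () _ _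
    ... | leftEdge a b refl refl ha hb v | outerEdge () _
    ... | leftEdge a b refl refl ha hb v | leftEdge a′ b′ refl refl _ _ v′ = Eq.cong suc (M₁.uniqueRet a b b′ v v′)
    ... | leftEdge a b refl refl ha hb v | rightEdge a′ b′ e _ _ = ⊥-elim (below-offset ha (ℕP.suc-injective e))
    ... | rightEdge a b refl refl v | outerEdge () _
    ... | rightEdge a b refl refl v | leftEdge a′ b′ e _ ha′ _ _ = ⊥-elim (below-offset ha′ (Eq.sym (ℕP.suc-injective e)))
    ... | rightEdge a b refl refl v | rightEdge a′ b′ e refl v′ with offset-injective s e
    ...   | refl = Eq.cong (λ x → suc (s + suc x)) (M₂.uniqueRet a b b′ v v′)
    uniqueCall′ : ∀ i i′ j → callBlock s N₁ N₂ i j ≡ true → callBlock s N₁ N₂ i′ j ≡ true → i ≡ i′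
    uniqueCall′ i i′ j e₁ e₂ with edge i j e₁ | edge i′ j e₂
    ... | outerEdge r₁ _ | outerEdge r₁′ _ = Eq.trans r₁ (Eq.sym r₁′)
    ... | outerEdge _ refl | leftEdge a b _ e _ hb _ = ⊥-elim (below-offset hb (Eq.sym (ℕP.suc-injective e)))
    ... | outerEdge _ refl | rightEdge a b _ e _ = ⊥-elim (ℕP.<-irrefl (ℕP.suc-injective e) (ℕP.+-monoʳ-< s (s≤s z≤n)))
    ... | leftEdge a b refl refl ha hb v | outerEdge _ e = ⊥-elim (below-offset hb (ℕP.suc-injective e))
    ... | leftEdge a b refl refl ha hb v | leftEdge a′ b′ refl refl _ _ v′ = Eq.cong suc (M₁.uniqueCall a a′ b v v′)
    ... | leftEdge a b refl refl ha hb v | rightEdge a′ b′ _ e _ = ⊥-elim (below-offset hb (ℕP.suc-injective e))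
    ... | rightEdge a b refl refl v | outerEdge _ e =
      ⊥-elim (ℕP.<-irrefl (Eq.sym (ℕP.suc-injective e)) (ℕP.+-monoʳ-< s (s≤s z≤n)))
    ... | rightEdge a b refl refl v | leftEdge a′ b′ _ e _ hb′ _ = ⊥-elim (below-offset hb′ (Eq.sym (ℕP.suc-injective e)))
    ... | rightEdge a b refl refl v | rightEdge a′ b′ refl e v′ with offset-injective s e
    ...   | refl = Eq.cong (λ x → suc (s + suc x)) (M₂.uniqueCall a a′ b v v′)
    noCross′ : ∀ i j i′ j′ → callBlock s N₁ N₂ i j ≡ true → callBlock s N₁ N₂ i′ j′ ≡ true → i < i′ →
               (j < i′) ⊎ (j′ < j)
    noCross′ i j i′ j′ e₁ e₂ lt with edge i j e₁ | edge i′ j′ e₂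
    noCross′ i j i′ j′ e₁ e₂ () | outerEdge refl refl | outerEdge refl refl
    ... | outerEdge refl refl | leftEdge a′ b′ refl refl ha′ hb′ v′ = inj₂ (s≤s (ℕP.<-≤-trans hb′ (ℕP.m≤m+n s 0)))
    ... | outerEdge refl refl | rightEdge a′ b′ refl refl v′ = inj₁ (s≤s (ℕP.+-monoʳ-< s (s≤s z≤n)))
    noCross′ i j i′ j′ e₁ e₂ () | leftEdge a b refl refl ha hb v | outerEdge refl refl
    ... | leftEdge a b refl refl ha hb v | leftEdge a′ b′ refl refl ha′ hb′ v′ with M₁.noCross a b a′ b′ v v′ (ℕP.≤-pred lt)
    ...   | inj₁ x = inj₁ (s≤s x)
    ...   | inj₂ y = inj₂ (s≤s y)
    noCross′ i j i′ j′ e₁ e₂ lt | leftEdge a b refl refl ha hb v | rightEdge a′ b′ refl refl v′ =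
      inj₁ (s≤s (ℕP.<-≤-trans hb (ℕP.m≤m+n s _)))
    noCross′ i j i′ j′ e₁ e₂ () | rightEdge a b refl refl v | outerEdge refl refl
    noCross′ i j i′ j′ e₁ e₂ lt | rightEdge a b refl refl v | leftEdge a′ b′ refl refl ha′ hb′ v′ =
      ⊥-elim (ℕP.<-asym (ℕP.<-≤-trans ha′ (ℕP.m≤m+n s _)) (ℕP.≤-pred lt))
    noCross′ i j i′ j′ e₁ e₂ lt | rightEdge a b refl refl v | rightEdge a′ b′ refl refl v′
      with M₂.noCross a b a′ b′ v v′ (ℕP.≤-pred (ℕP.+-cancelˡ-< s _ _ (ℕP.≤-pred lt)))
    ...   | inj₁ x = inj₁ (s≤s (ℕP.+-monoʳ-< s (s≤s x)))
    ...   | inj₂ y = inj₂ (s≤s (ℕP.+-monoʳ-< s (s≤s y)))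

module CallBlockPositions (s : ℕ) (N₁ N₂ : ℕ → ℕ → Bool) where
  private
    B = callBlock s N₁ N₂

  notReturn-inner : ∀ j → j < s → (∀ i → N₁ i j ≡ false) → ∀ i → B i (suc j) ≡ false
  notReturn-inner j h none zero    = ¬-not λ e → ℕP.<-irrefl (Eq.sym (≡ᵇ-sound s j e)) h
  notReturn-inner j h none (suc i) with split s i
  ... | inj₁ hi         = Eq.trans (blockDiag-ll s N₁ (shiftRel N₂) i j hi h) (none i)
  ... | inj₂ (u , refl) = blockDiag-rl s N₁ (shiftRel N₂) u j h

  notCall-inner : ∀ j → j < s → (∀ c → N₁ j c ≡ false) → ∀ c → B (suc j) c ≡ false
  notCall-inner j h none zero    = refl
  notCall-inner j h none (suc c) with split s c
  ... | inj₁ hc         = Eq.trans (blockDiag-ll s N₁ (shiftRel N₂) j c h hc) (none c)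
  ... | inj₂ (u , refl) = blockDiag-lr s N₁ (shiftRel N₂) j u h

  notReturn-outer : ∀ j → (∀ i → N₂ i j ≡ false) → ∀ i → B i (suc (s + suc j)) ≡ false
  notReturn-outer j none zero    = ¬-not λ e → ℕP.<-irrefl (≡ᵇ-sound s _ e) (offset-above s j)
  notReturn-outer j none (suc i) with split s i
  ... | inj₁ hi             = blockDiag-lr s N₁ (shiftRel N₂) i (suc j) hi
  ... | inj₂ (zero , refl)  = blockDiag-rr s N₁ (shiftRel N₂) 0 (suc j)
  ... | inj₂ (suc u , refl) = Eq.trans (blockDiag-rr s N₁ (shiftRel N₂) (suc u) (suc j)) (none u)

  notCall-outer : ∀ j → (∀ c → N₂ j c ≡ false) → ∀ c → B (suc (s + suc j)) c ≡ false
  notCall-outer j none zero    = refl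
  notCall-outer j none (suc c) with split s c
  ... | inj₁ hc             = blockDiag-rl s N₁ (shiftRel N₂) (suc j) c hc
  ... | inj₂ (zero , refl)  = blockDiag-rr s N₁ (shiftRel N₂) (suc j) 0
  ... | inj₂ (suc u , refl) = Eq.trans (blockDiag-rr s N₁ (shiftRel N₂) (suc j) (suc u)) (none u)

firstTrue-just : ∀ {n} (p : Fin n → Bool) i → firstTrue p ≡ just i → p i ≡ true
firstTrue-just {suc n} p i e with p F.zero in eq
... | true with e
...   | refl = eq
firstTrue-just {suc n} p i e | false with firstTrue (λ i → p (F.suc i)) in eq′
...   | just j with e
...     | refl = firstTrue-just _ j eq′
firstTrue-just {suc n} p i () | false | nothing

firstTrue-nothing : ∀ {n} (p : Fin n → Bool) → firstTrue p ≡ nothing → ∀ i → p i ≡ false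
firstTrue-nothing {suc n} p e i with p F.zero in eq
firstTrue-nothing {suc n} p () i | true
... | false with firstTrue (λ i → p (F.suc i)) in eq′
firstTrue-nothing {suc n} p () i         | false | just j
firstTrue-nothing {suc n} p e F.zero     | false | nothing = eq
firstTrue-nothing {suc n} p e (F.suc i)  | false | nothing = firstTrue-nothing _ eq′ i

module SemiringFacts {c ℓ} (K : CommutativeSemiring c ℓ) where
  open CommutativeSemiring K
    using (Carrier; _≈_; _*_; 0#; 1#; +-cong; +-identityˡ; *-congˡ; *-assoc; *-identityˡ)
    renaming (refl to ≈-refl; sym to ≈-sym; trans to ≈-trans; reflexive to ≈-reflexive)

  ∑-zero : ∀ {n} (f : Fin n → Carrier) → (∀ i → f i ≈ 0#) → ∑ K f ≈ 0#
  ∑-zero {zero}  f h = ≈-refl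
  ∑-zero {suc n} f h = ≈-trans (+-cong (h F.zero) (∑-zero _ (λ j → h (F.suc j)))) (+-identityˡ 0#)

  ∑seq-zero : ∀ {k} m (G : (Fin m → Fin k) → Carrier) → (∀ g → G g ≈ 0#) → ∑seq K m G ≈ 0#
  ∑seq-zero zero    G h = h _
  ∑seq-zero {k} (suc m) G h = ∑-zero {k} _ (λ q → ∑seq-zero m _ (λ r → h _))

  module _ (zsf : ZeroSumFree K) where
    ∑-zero⁻¹ : ∀ {n} (f : Fin n → Carrier) → ∑ K f ≈ 0# → ∀ i → f i ≈ 0#
    ∑-zero⁻¹ {suc n} f h F.zero    = proj₁ (zsf _ _ h)
    ∑-zero⁻¹ {suc n} f h (F.suc i) = ∑-zero⁻¹ (λ j → f (F.suc j)) (proj₂ (zsf _ _ h)) i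

    ∑seq-zero⁻¹ : ∀ {k} m (G : (Fin m → Fin k) → Carrier) → ∑seq K m G ≈ 0# →
                  ∀ (g : Fin m → Fin k) → Σ (Fin m → Fin k) λ g′ → (∀ (i : Fin m) → g′ i ≡ g i) × G g′ ≈ 0#

    -- The inductive step, stated for any `cons` behaving like the sequence
    -- constructor used in the definition of ∑seq.
    ∑seq-zero⁻¹-step : ∀ {k} m (G : (Fin (suc m) → Fin k) → Carrier)
                       (cons : Fin k → (Fin m → Fin k) → Fin (suc m) → Fin k) →
                       (∀ q r → cons q r F.zero ≡ q) → (∀ q r (i : Fin m) → cons q r (F.suc i) ≡ r i) →
                       ∑ K {k} (λ q → ∑seq K m (λ r → G (cons q r))) ≈ 0# →
                       ∀ (g : Fin (suc m) → Fin k) →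
                       Σ (Fin (suc m) → Fin k) λ g′ → (∀ (i : Fin (suc m)) → g′ i ≡ g i) × G g′ ≈ 0#
    ∑seq-zero⁻¹-step m G cons cons-zero cons-suc h g
      with ∑seq-zero⁻¹ m (λ r → G (cons (g F.zero) r))
             (∑-zero⁻¹ (λ q → ∑seq K m (λ r → G (cons q r))) h (g F.zero)) (λ i → g (F.suc i))
    ... | r , r≗ , z =
      cons (g F.zero) r , (λ { F.zero → cons-zero _ _ ; (F.suc i) → Eq.trans (cons-suc _ _ i) (r≗ i) }) , z

    ∑seq-zero⁻¹ zero    G h g = (λ ()) , (λ ()) , h
    ∑seq-zero⁻¹ (suc m) G h g = ∑seq-zero⁻¹-step m G _ (λ q r → refl) (λ q r i → refl) h g

  -- ∏ℕ g a l = g a * g (a + 1) * … * g (a + l - 1): products over ℕ-intervals,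
  -- the form in which run weights are cut into the weights of subwords.
  ∏ℕ : (ℕ → Carrier) → ℕ → ℕ → Carrier
  ∏ℕ g a zero    = 1#
  ∏ℕ g a (suc l) = g a * ∏ℕ g (suc a) l

  ∏ℕ-split : ∀ g a l₁ l₂ → ∏ℕ g a (l₁ + l₂) ≈ ∏ℕ g a l₁ * ∏ℕ g (a + l₁) l₂
  ∏ℕ-split g a zero     l₂ rewrite ℕP.+-identityʳ a = ≈-sym (*-identityˡ _)
  ∏ℕ-split g a (suc l₁) l₂ rewrite ℕP.+-suc a l₁ =
    ≈-trans (*-congˡ (∏ℕ-split g (suc a) l₁ l₂)) (≈-sym (*-assoc _ _ _))

  ∏ℕ-cong : ∀ g g′ a l → (∀ m → g m ≡ g′ m) → ∏ℕ g a l ≡ ∏ℕ g′ a l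
  ∏ℕ-cong g g′ a zero    h = refl
  ∏ℕ-cong g g′ a (suc l) h = Eq.cong₂ _*_ (h a) (∏ℕ-cong g g′ (suc a) l h)

  ∏ℕ-shift : ∀ g a l → ∏ℕ g (suc a) l ≡ ∏ℕ (λ m → g (suc m)) a l
  ∏ℕ-shift g a zero    = refl
  ∏ℕ-shift g a (suc l) = Eq.cong (g (suc a) *_) (∏ℕ-shift g (suc a) l)

  ∏ℕ-offset : ∀ g a l → ∏ℕ g a l ≡ ∏ℕ (λ m → g (a + m)) 0 l
  ∏ℕ-offset g zero    l = refl
  ∏ℕ-offset g (suc a) l = Eq.trans (∏ℕ-shift g a l) (∏ℕ-offset (λ m → g (suc m)) a l)

  ∏-extend : ∀ {n} (f : Fin n → Carrier) x → ∏ K f ≈ ∏ℕ (extend f x) 0 n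
  ∏-extend {zero}  f x = ≈-refl
  ∏-extend {suc n} f x =
    *-congˡ (≈-trans (∏-extend (λ i → f (F.suc i)) x) (≈-reflexive (Eq.sym (∏ℕ-shift (extend f x) 0 n))))

  ∏[_,_⟩ : ℕ → ℕ → (ℕ → Carrier) → Carrier
  ∏[ a , b ⟩ g = ∏ℕ g a (b ∸ a)

  ∏[⟩-empty : ∀ g a → ∏[ a , a ⟩ g ≈ 1#
  ∏[⟩-empty g a rewrite ℕP.n∸n≡0 a = ≈-refl

  ∏[⟩-step : ∀ g a b → a < b → ∏[ a , b ⟩ g ≈ g a * ∏[ suc a , b ⟩ g
  ∏[⟩-step g a b h with ℕP.m≤n⇒∃[o]m+o≡n h
  ... | l , refl rewrite ℕP.m+n∸m≡n (suc a) l | Eq.sym (ℕP.+-suc a l) | ℕP.m+n∸m≡n a (suc l) = ≈-refl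

  ∏[⟩-split : ∀ g a m b → a ≤ m → m ≤ b → ∏[ a , b ⟩ g ≈ ∏[ a , m ⟩ g * ∏[ m , b ⟩ g
  ∏[⟩-split g a m b h₁ h₂ with ℕP.m≤n⇒∃[o]m+o≡n h₁
  ... | l₁ , refl with ℕP.m≤n⇒∃[o]m+o≡n h₂
  ... | l₂ , refl rewrite ℕP.m+n∸m≡n a l₁ | ℕP.m+n∸m≡n (a + l₁) l₂ | ℕP.+-assoc a l₁ l₂
                        | ℕP.m+n∸m≡n a (l₁ + l₂) = ∏ℕ-split g a l₁ l₂

module Runs {c ℓ} (K : CommutativeSemiring c ℓ) {d k : ℕ} (A : WNWA K d k) where
  open CommutativeSemiring K
    using (Carrier; _≈_; _*_; 1#; *-cong; *-congˡ; *-commutativeSemigroup; *-monoid; setoid)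
    renaming (refl to ≈-refl; trans to ≈-trans; reflexive to ≈-reflexive)
  open import Algebra.Properties.CommutativeSemigroup.Divisibility *-commutativeSemigroup
    using (_∣_; ∣ʳ-trans; x∣ʳyx; x∣xy; ∙-cong-∣)
  open import Algebra.Properties.Monoid.Divisibility *-monoid using (∣ʳ-refl)
  open Relation.Binary.Reasoning.Setoid setoid
  open WNWA A
  open SemiringFacts K

  -- A run tree for the pair of states (p , r) describes a run from p to r on a
  -- well-matched nested word: it is empty (p = r), an internal transition
  -- followed by a run tree, or a call, a run tree for the enclosed subword,
  -- the matching return, and a run tree for the rest of the word.
  data RunTree : Fin k → Fin k → Set where
    done     : ∀ {p} → RunTree p p
    internal : ∀ {p r} (a : Fin d) (p′ : Fin k) → RunTree p′ r → RunTree p r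
    block    : ∀ {p r} (a : Fin d) (p₁ p₂ : Fin k) → RunTree p₁ p₂ →
               (b : Fin d) (p₃ : Fin k) → RunTree p₃ r → RunTree p r

  weight : ∀ {p r} → RunTree p r → Carrier
  weight done                           = 1#
  weight {p} (internal a p′ t)          = δint p a p′ * weight t
  weight {p} (block a p₁ p₂ t₁ b p₃ t₂) = δcall p a p₁ * (weight t₁ * (δret p₂ p b p₃ * weight t₂))

  NonEmpty : ∀ {p r} → RunTree p r → Set
  NonEmpty done = ⊥
  NonEmpty _    = ⊤

  internal-child∣ : ∀ {p r} a p′ (t : RunTree p′ r) → weight t ∣ weight (internal {p} a p′ t)
  internal-child∣ {p} a p′ t = x∣ʳyx (weight t) (δint p a p′)

  block-left∣ : ∀ {p r} a p₁ p₂ (t₁ : RunTree p₁ p₂) b p₃ (t₂ : RunTree p₃ r) →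
                weight t₁ ∣ weight (block {p} a p₁ p₂ t₁ b p₃ t₂)
  block-left∣ {p} a p₁ p₂ t₁ b p₃ t₂ = ∣ʳ-trans (x∣xy (weight t₁) _) (x∣ʳyx _ (δcall p a p₁))

  block-right∣ : ∀ {p r} a p₁ p₂ (t₁ : RunTree p₁ p₂) b p₃ (t₂ : RunTree p₃ r) →
                 weight t₂ ∣ weight (block {p} a p₁ p₂ t₁ b p₃ t₂)
  block-right∣ {p} a p₁ p₂ t₁ b p₃ t₂ =
    ∣ʳ-trans (x∣ʳyx (weight t₂) (δret p₂ p b p₃)) (∣ʳ-trans (x∣ʳyx _ (weight t₁)) (x∣ʳyx _ (δcall p a p₁)))

  internal-mono∣ : ∀ {p r} a p′ (t t′ : RunTree p′ r) → weight t′ ∣ weight t →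
                   weight (internal {p} a p′ t′) ∣ weight (internal a p′ t)
  internal-mono∣ a p′ t t′ dv = ∙-cong-∣ ∣ʳ-refl dv

  block-mono∣ : ∀ {p r} a p₁ p₂ (t₁ t₁′ : RunTree p₁ p₂) b p₃ (t₂ t₂′ : RunTree p₃ r) →
                weight t₁′ ∣ weight t₁ → weight t₂′ ∣ weight t₂ →
                weight (block {p} a p₁ p₂ t₁′ b p₃ t₂′) ∣ weight (block a p₁ p₂ t₁ b p₃ t₂)
  block-mono∣ a p₁ p₂ t₁ t₁′ b p₃ t₂ t₂′ dv₁ dv₂ = ∙-cong-∣ ∣ʳ-refl (∙-cong-∣ dv₁ (∙-cong-∣ ∣ʳ-refl dv₂))

  -- The label of a subtree is the pair of its end states; there are k² labels.
  Label : Set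
  Label = Fin k × Fin k

  _≟ₗ_ : (X Y : Label) → Dec (X ≡ Y)
  _≟ₗ_ = ≡-dec FP._≟_ FP._≟_

  LabelsIn : List Label → ∀ {p r} → RunTree p r → Set
  LabelsIn S {p} {r} done                     = (p , r) ∈ S
  LabelsIn S {p} {r} (internal a p′ t)        = (p , r) ∈ S × LabelsIn S t
  LabelsIn S {p} {r} (block a p₁ p₂ t₁ b p₃ t₂) = (p , r) ∈ S × LabelsIn S t₁ × LabelsIn S t₂

  rootIn : ∀ {S p r} (t : RunTree p r) → LabelsIn S t → (p , r) ∈ S
  rootIn done                       m       = m
  rootIn (internal a p′ t)          (m , _) = m
  rootIn (block a p₁ p₂ t₁ b p₃ t₂) (m , _) = m

  Avoids : Label → ∀ {p r} → RunTree p r → Set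
  Avoids X {p} {r} done                       = (p , r) ≢ X
  Avoids X {p} {r} (internal a p′ t)          = (p , r) ≢ X × Avoids X t
  Avoids X {p} {r} (block a p₁ p₂ t₁ b p₃ t₂) = (p , r) ≢ X × Avoids X t₁ × Avoids X t₂

  ChildrenAvoid : Label → ∀ {p r} → RunTree p r → Set
  ChildrenAvoid X done                       = ⊤
  ChildrenAvoid X (internal a p′ t)          = Avoids X t
  ChildrenAvoid X (block a p₁ p₂ t₁ b p₃ t₂) = Avoids X t₁ × Avoids X t₂

  root-not-avoided : ∀ {p r} (t : RunTree p r) → ¬ Avoids (p , r) t
  root-not-avoided done                       ne       = ne refl
  root-not-avoided (internal a p′ t)          (ne , _) = ne refl
  root-not-avoided (block a p₁ p₂ t₁ b p₃ t₂) (ne , _) = ne refl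

  _≢?_ : (Y X : Label) → Dec (Y ≢ X)
  Y ≢? X = ¬? (Y ≟ₗ X)

  without : Label → List Label → List Label
  without X = filter (_≢? X)

  without-shorter : ∀ {X S} → X ∈ S → length (without X S) < length S
  without-shorter {X} {S} m = filter-notAll (_≢? X) S (lose m (λ ne → ne refl))

  without-bound : ∀ {X S n} → X ∈ S → length S ≤ suc n → length (without X S) ≤ n
  without-bound m len = ℕP.≤-pred (ℕP.<-≤-trans (without-shorter m) len)

  LabelsIn-without : ∀ {X S p r} (t : RunTree p r) → LabelsIn S t → Avoids X t → LabelsIn (without X S) t
  LabelsIn-without {X} done m ne = ∈-filter⁺ (_≢? X) m ne
  LabelsIn-without {X} (internal a p′ t) (m , l) (ne , av) =
    ∈-filter⁺ (_≢? X) m ne , LabelsIn-without t l av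
  LabelsIn-without {X} (block a p₁ p₂ t₁ b p₃ t₂) (m , l₁ , l₂) (ne , av₁ , av₂) =
    ∈-filter⁺ (_≢? X) m ne , LabelsIn-without t₁ l₁ av₁ , LabelsIn-without t₂ l₂ av₂

  record Innermost (S : List Label) (p₀ r₀ : Fin k) {p r} (t : RunTree p r) : Set (c ⊔ ℓ) where
    constructor innermostAt
    field
      subtree       : RunTree p₀ r₀
      divides       : weight subtree ∣ weight t
      childrenAvoid : ChildrenAvoid (p₀ , r₀) subtree
      labelsIn      : LabelsIn S t → LabelsIn S subtree

  innermost : ∀ S p₀ r₀ {p r} (t : RunTree p r) → Avoids (p₀ , r₀) t ⊎ Innermost S p₀ r₀ t
  innermost S p₀ r₀ {p} {r} done with (p , r) ≟ₗ (p₀ , r₀)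
  ... | yes refl = inj₂ (innermostAt done ∣ʳ-refl tt (λ l → l))
  ... | no ne    = inj₁ ne
  innermost S p₀ r₀ {p} {r} (internal a p′ t) with innermost S p₀ r₀ t
  ... | inj₂ (innermostAt s dv ch l) = inj₂ (innermostAt s (∣ʳ-trans dv (internal-child∣ a p′ t)) ch (l ∘ proj₂))
  ... | inj₁ av with (p , r) ≟ₗ (p₀ , r₀)
  ...   | yes refl = inj₂ (innermostAt (internal a p′ t) ∣ʳ-refl av (λ l → l))
  ...   | no ne    = inj₁ (ne , av)
  innermost S p₀ r₀ {p} {r} (block a p₁ p₂ t₁ b p₃ t₂) with innermost S p₀ r₀ t₁
  ... | inj₂ (innermostAt s dv ch l) =
    inj₂ (innermostAt s (∣ʳ-trans dv (block-left∣ a p₁ p₂ t₁ b p₃ t₂)) ch (l ∘ proj₁ ∘ proj₂))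
  ... | inj₁ av₁ with innermost S p₀ r₀ t₂
  ...   | inj₂ (innermostAt s dv ch l) =
    inj₂ (innermostAt s (∣ʳ-trans dv (block-right∣ a p₁ p₂ t₁ b p₃ t₂)) ch (l ∘ proj₂ ∘ proj₂))
  ...   | inj₁ av₂ with (p , r) ≟ₗ (p₀ , r₀)
  ...     | yes refl = inj₂ (innermostAt (block a p₁ p₂ t₁ b p₃ t₂) ∣ʳ-refl (av₁ , av₂) (λ l → l))
  ...     | no ne    = inj₁ (ne , av₁ , av₂)

  HeightAtMost : ℕ → ∀ {p r} → RunTree p r → Set
  HeightAtMost zero    t                          = ⊥
  HeightAtMost (suc n) done                       = ⊤
  HeightAtMost (suc n) (internal a p′ t)          = HeightAtMost n t
  HeightAtMost (suc n) (block a p₁ p₂ t₁ b p₃ t₂) = HeightAtMost n t₁ × HeightAtMost n t₂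

  -- Replace the tree by an innermost occurrence of its root
  -- label; its children avoid that label, so their labels lie in a shorter list.
  pump : ∀ n S → length S ≤ n → ∀ {p r} (t : RunTree p r) → LabelsIn S t →
         Σ (RunTree p r) λ t′ → HeightAtMost n t′ × weight t′ ∣ weight t
  pumpChildren : ∀ n S → length S ≤ suc n → ∀ {p r} (s : RunTree p r) → LabelsIn S s →
                 ChildrenAvoid (p , r) s → Σ (RunTree p r) λ t′ → HeightAtMost (suc n) t′ × weight t′ ∣ weight s

  pump zero [] len t l with rootIn t l
  ... | ()
  pump (suc n) S len {p} {r} t l with innermost S p r t
  ... | inj₁ av = ⊥-elim (root-not-avoided t av)
  ... | inj₂ (innermostAt s dv ch ls) with pumpChildren n S len s (ls l) ch
  ...   | t′ , h , dv′ = t′ , h , ∣ʳ-trans dv′ dv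

  pumpChildren n S len done l ch = done , tt , ∣ʳ-refl
  pumpChildren n S len {p} {r} (internal a p′ t) (m , l) av
    with pump n (without (p , r) S) (without-bound m len) t (LabelsIn-without t l av)
  ... | t′ , h , dv = internal a p′ t′ , h , internal-mono∣ a p′ t t′ dv
  pumpChildren n S len {p} {r} (block a p₁ p₂ t₁ b p₃ t₂) (m , l₁ , l₂) (av₁ , av₂)
    with pump n (without (p , r) S) (without-bound m len) t₁ (LabelsIn-without t₁ l₁ av₁)
       | pump n (without (p , r) S) (without-bound m len) t₂ (LabelsIn-without t₂ l₂ av₂)
  ... | t₁′ , h₁ , dv₁ | t₂′ , h₂ , dv₂ =
    block a p₁ p₂ t₁′ b p₃ t₂′ , (h₁ , h₂) , block-mono∣ a p₁ p₂ t₁ t₁′ b p₃ t₂ t₂′ dv₁ dv₂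

  forEach : ∀ {X Y : Set} → List X → (X → List Y) → List Y
  forEach xs f = concatMap f xs

  ∈-forEach : ∀ {X Y : Set} {xs : List X} {f : X → List Y} {x y} → x ∈ xs → y ∈ f x → y ∈ forEach xs f
  ∈-forEach {f = f} x∈xs y∈fx = ∈-concatMap⁺ f (lose x∈xs y∈fx)

  trees : ℕ → ∀ p r → List (RunTree p r)
  internals : ℕ → ∀ p r → List (RunTree p r)
  blocks : ℕ → ∀ p r → List (RunTree p r)
  dones : ∀ p r → List (RunTree p r)
  dones p r with p FP.≟ r
  ... | yes refl = done ∷ []
  ... | no _     = []
  trees zero    p r = []
  trees (suc n) p r = dones p r ++ (internals n p r ++ blocks n p r)
  internals n p r =
    forEach (allFin d) λ a → forEach (allFin k) λ p′ → map (internal a p′) (trees n p′ r)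
  blocks n p r =
    forEach (allFin d) λ a → forEach (allFin k) λ p₁ → forEach (allFin k) λ p₂ → forEach (allFin d) λ b →
    forEach (allFin k) λ p₃ → forEach (trees n p₁ p₂) λ t₁ → map (block a p₁ p₂ t₁ b p₃) (trees n p₃ r)

  trees-complete : ∀ n {p r} (t : RunTree p r) → HeightAtMost n t → t ∈ trees n p r
  internals-complete : ∀ n {p r} a p′ (t : RunTree p′ r) → HeightAtMost n t → internal {p} a p′ t ∈ internals n p r
  blocks-complete : ∀ n {p r} a p₁ p₂ (t₁ : RunTree p₁ p₂) b p₃ (t₂ : RunTree p₃ r) →
                    HeightAtMost n t₁ → HeightAtMost n t₂ → block {p} a p₁ p₂ t₁ b p₃ t₂ ∈ blocks n p r
  internals-complete n a p′ t h =
    ∈-forEach (∈-allFin a) (∈-forEach (∈-allFin p′) (∈-map⁺ _ (trees-complete n t h)))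
  blocks-complete n a p₁ p₂ t₁ b p₃ t₂ h₁ h₂ =
    ∈-forEach (∈-allFin a) (∈-forEach (∈-allFin p₁) (∈-forEach (∈-allFin p₂) (∈-forEach (∈-allFin b)
      (∈-forEach (∈-allFin p₃) (∈-forEach (trees-complete n t₁ h₁) (∈-map⁺ _ (trees-complete n t₂ h₂)))))))
  trees-complete (suc n) {p} done h with p FP.≟ p
  ... | yes refl = here refl
  ... | no ne    = ⊥-elim (ne refl)
  trees-complete (suc n) {p} {r} (internal a p′ t) h =
    ∈-++⁺ʳ (dones p r) (∈-++⁺ˡ (internals-complete n a p′ t h))
  trees-complete (suc n) {p} {r} (block a p₁ p₂ t₁ b p₃ t₂) (h₁ , h₂) =
    ∈-++⁺ʳ (dones p r) (∈-++⁺ʳ (internals n p r) (blocks-complete n a p₁ p₂ t₁ b p₃ t₂ h₁ h₂))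

  -- s j is the weight of the transition that the run with states Q 0, Q 1, …
  -- takes at position j of the word of length n with letters L and nesting N.
  record StepWeights (n : ℕ) (N : ℕ → ℕ → Bool) (L : ℕ → Fin d) (Q : ℕ → Fin k)
                     (s : ℕ → Carrier) : Set (c ⊔ ℓ) where
    field
      atReturn   : ∀ i j → N i j ≡ true → s j ≈ δret (Q j) (Q i) (L j) (Q (suc j))
      atCall     : ∀ j c → (∀ i → N i j ≡ false) → N j c ≡ true → s j ≈ δcall (Q j) (L j) (Q (suc j))
      atInternal : ∀ j → j < n → (∀ i → N i j ≡ false) → (∀ c → N j c ≡ false) →
                   s j ≈ δint (Q j) (L j) (Q (suc j))

  module Parse {n N L Q s} (nest : IsNestingℕ n N) (sw : StepWeights n N L Q s) where
    open IsNestingℕ nest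
    open StepWeights sw

    Closed : ℕ → ℕ → Set
    Closed a b = ∀ i j → N i j ≡ true → (a ≤ i → i < b → j < b) × (a ≤ j → j < b → a ≤ i)

    outgoing : ∀ a → (Σ ℕ λ c → N a c ≡ true) ⊎ (∀ c → N a c ≡ false)
    outgoing a with FP.any? {n} (λ c → N a (toℕ c) ≟ᵇ true)
    ... | yes (c , e) = inj₁ (toℕ c , e)
    ... | no none     = inj₂ λ c → ¬-not λ e →
      none (F.fromℕ< (proj₂ (range a c e)) , Eq.subst (λ m → N a m ≡ true) (Eq.sym (FP.toℕ-fromℕ< _)) e)

    first-notReturn : ∀ a b → Closed a b → a < b → ∀ i → N i a ≡ false
    first-notReturn a b cl a<b i =
      ¬-not λ e → ℕP.<⇒≱ (proj₁ (range i a e)) (proj₂ (cl i a e) ℕP.≤-refl a<b)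

    closed-afterInternal : ∀ a b → Closed a b → (∀ c → N a c ≡ false) → Closed (suc a) b
    closed-afterInternal a b cl none i j e =
        (λ h₁ h₂ → proj₁ (cl i j e) (ℕP.≤-trans (ℕP.n≤1+n a) h₁) h₂)
      , (λ h₁ h₂ → ℕP.≤∧≢⇒< (proj₂ (cl i j e) (ℕP.≤-trans (ℕP.n≤1+n a) h₁) h₂)
                            (λ { refl → true≢false (Eq.trans (Eq.sym e) (none j)) }))

    closed-inside : ∀ a b c → Closed a b → N a c ≡ true → c < b → Closed (suc a) c
    closed-inside a b c cl ac c<b i j e =
        (λ h₁ h₂ → inside (noCross a c i j ac e h₁) h₂)
      , (λ h₁ h₂ → ℕP.≤∧≢⇒< (proj₂ (cl i j e) (ℕP.≤-trans (ℕP.n≤1+n a) h₁) (ℕP.<-trans h₂ c<b))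
                            (λ { refl → ℕP.<-irrefl (uniqueRet a j c e ac) h₂ }))
      where
        inside : ∀ {i j} → (c < i) ⊎ (j < c) → i < c → j < c
        inside (inj₁ c<i) i<c = ⊥-elim (ℕP.<-asym c<i i<c)
        inside (inj₂ j<c) _   = j<c

    closed-afterBlock : ∀ a b c → Closed a b → N a c ≡ true → Closed (suc c) b
    closed-afterBlock a b c cl ac i j e =
        (λ h₁ h₂ → proj₁ (cl i j e) (a≤ h₁) h₂)
      , (λ h₁ h₂ → beyond i j e h₁ (proj₂ (cl i j e) (a≤ h₁) h₂))
      where
        a≤ : ∀ {m} → suc c ≤ m → a ≤ m
        a≤ h = ℕP.≤-trans (ℕP.<⇒≤ (proj₁ (range a c ac))) (ℕP.≤-trans (ℕP.n≤1+n c) h)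
        beyond : ∀ i j → N i j ≡ true → suc c ≤ j → a ≤ i → suc c ≤ i
        beyond i j e c<j a≤i with ℕP.<-cmp i c
        ... | tri> _ _ c<i = c<i
        ... | tri≈ _ refl _ with noCross a c c j ac e (proj₁ (range a c ac))
        ...   | inj₁ c<c = ⊥-elim (ℕP.<-irrefl refl c<c)
        ...   | inj₂ j<c = ⊥-elim (ℕP.<-asym j<c c<j)
        beyond i j e c<j a≤i | tri< i<c _ _ with ℕP.m≤n⇒m<n∨m≡n a≤i
        ...   | inj₂ refl = ⊥-elim (ℕP.<-irrefl (uniqueRet a c j ac e) c<j)
        ...   | inj₁ a<i with noCross a c i j ac e a<i
        ...     | inj₁ c<i = ⊥-elim (ℕP.<-asym c<i i<c)
        ...     | inj₂ j<c = ⊥-elim (ℕP.<-asym j<c c<j)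

    Parsed : ℕ → ℕ → Set ℓ
    Parsed a b = Σ (RunTree (Q a) (Q b)) λ t → (∏[ a , b ⟩ s ≈ weight t) × (a < b → NonEmpty t)

    parse-internal : ∀ a b → a < b → b ≤ n → Closed a b → (∀ c → N a c ≡ false) →
                     Parsed (suc a) b → Parsed a b
    parse-internal a b a<b b≤n cl none (t , w , _) = internal (L a) (Q (suc a)) t , eq , λ _ → tt
      where
        eq : ∏[ a , b ⟩ s ≈ weight (internal {Q a} (L a) (Q (suc a)) t)
        eq = begin
          ∏[ a , b ⟩ s               ≈⟨ ∏[⟩-step s a b a<b ⟩
          s a * ∏[ suc a , b ⟩ s     ≈⟨ *-cong (atInternal a (ℕP.<-≤-trans a<b b≤n) (first-notReturn a b cl a<b) none) w ⟩
          δint (Q a) (L a) (Q (suc a)) * weight t ∎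

    parse-block : ∀ a b c → a < b → Closed a b → N a c ≡ true →
                  Parsed (suc a) c → Parsed (suc c) b → Parsed a b
    parse-block a b c a<b cl ac (t₁ , w₁ , _) (t₂ , w₂ , _) =
      block (L a) (Q (suc a)) (Q c) t₁ (L c) (Q (suc c)) t₂ , eq , λ _ → tt
      where
        a<c = proj₁ (range a c ac)
        c<b = proj₁ (cl a c ac) ℕP.≤-refl a<b
        eq : ∏[ a , b ⟩ s ≈ weight (block {Q a} (L a) (Q (suc a)) (Q c) t₁ (L c) (Q (suc c)) t₂)
        eq = begin
          ∏[ a , b ⟩ s                                          ≈⟨ ∏[⟩-step s a b a<b ⟩
          s a * ∏[ suc a , b ⟩ s                                ≈⟨ *-congˡ (∏[⟩-split s (suc a) c b a<c (ℕP.<⇒≤ c<b)) ⟩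
          s a * (∏[ suc a , c ⟩ s * ∏[ c , b ⟩ s)               ≈⟨ *-congˡ (*-congˡ (∏[⟩-step s c b c<b)) ⟩
          s a * (∏[ suc a , c ⟩ s * (s c * ∏[ suc c , b ⟩ s))
            ≈⟨ *-cong (atCall a c (first-notReturn a b cl a<b) ac) (*-cong w₁ (*-cong (atReturn a c ac) w₂)) ⟩
          δcall (Q a) (L a) (Q (suc a)) * (weight t₁ * (δret (Q c) (Q a) (L c) (Q (suc c)) * weight t₂)) ∎

    -- Parse the closed interval [a, b) by recursion on a bound f for its length.
    parse : ∀ f a b → a ≤ b → b ≤ a + f → b ≤ n → Closed a b → Parsed a b
    parse f a b a≤b b≤ b≤n cl with a ℕ.<? b
    ... | no ¬a<b with ℕP.≤-antisym a≤b (ℕP.≮⇒≥ ¬a<b)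
    ...   | refl = done , ∏[⟩-empty s a , λ a<a → ⊥-elim (¬a<b a<a)
    parse zero a b a≤b b≤ b≤n cl | yes a<b =
      ⊥-elim (ℕP.<⇒≱ a<b (Eq.subst (b ≤_) (ℕP.+-identityʳ a) b≤))
    parse (suc f) a b a≤b b≤ b≤n cl | yes a<b with outgoing a
    ... | inj₂ none =
      parse-internal a b a<b b≤n cl none
        (parse f (suc a) b a<b (Eq.subst (b ≤_) (ℕP.+-suc a f) b≤) b≤n (closed-afterInternal a b cl none))
    ... | inj₁ (c , ac) =
      parse-block a b c a<b cl ac
        (parse f (suc a) c a<c c≤ (ℕP.≤-trans (ℕP.<⇒≤ c<b) b≤n) (closed-inside a b c cl ac c<b))
        (parse f (suc c) b c<b b≤′ b≤n (closed-afterBlock a b c cl ac))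
      where
        a<c = proj₁ (range a c ac)
        c<b = proj₁ (cl a c ac) ℕP.≤-refl a<b
        b≤1+a+f : b ≤ suc a + f
        b≤1+a+f = Eq.subst (b ≤_) (ℕP.+-suc a f) b≤
        c≤ : c ≤ suc a + f
        c≤ = ℕP.<⇒≤ (ℕP.<-≤-trans c<b b≤1+a+f)
        b≤′ : b ≤ suc c + f
        b≤′ = ℕP.≤-trans b≤1+a+f (ℕP.+-monoˡ-≤ f (ℕP.m≤n⇒m≤1+n a<c))

  module FinRun (w : NestedWord d) (q : Fin (suc (NestedWord.n w)) → Fin k) where
    open NestedWord w

    stepAt : Fin n → Carrier
    stepAt = stepWeight K A w q

    data StepKind (j : Fin n) (x : Carrier) : Set c where
      returnStep   : ∀ i → ν i j ≡ true →
                     x ≡ δret (q (F.inject₁ j)) (q (F.inject₁ i)) (letter j) (q (F.suc j)) → StepKind j x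
      callStep     : (∀ i → ν i j ≡ false) → ∀ c → ν j c ≡ true →
                     x ≡ δcall (q (F.inject₁ j)) (letter j) (q (F.suc j)) → StepKind j x
      internalStep : (∀ i → ν i j ≡ false) → (∀ c → ν j c ≡ false) →
                     x ≡ δint (q (F.inject₁ j)) (letter j) (q (F.suc j)) → StepKind j x

    stepKind : ∀ j → StepKind j (stepAt j)
    stepKind j with firstTrue (λ i → ν i j) in e₁
    ... | just i = returnStep i (firstTrue-just _ i e₁) refl
    ... | nothing with firstTrue (λ c → ν j c) in e₂
    ...   | just c  = callStep (firstTrue-nothing _ e₁) c (firstTrue-just _ c e₂) refl
    ...   | nothing = internalStep (firstTrue-nothing _ e₁) (firstTrue-nothing _ e₂) refl

    firstLetter : Fin d
    firstLetter with n | nonempty | letter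
    ... | suc _ | _ | f = f F.zero

    Lℕ : ℕ → Fin d
    Lℕ = extend letter firstLetter
    Nℕ : ℕ → ℕ → Bool
    Nℕ = extend₂ ν
    Qℕ : ℕ → Fin k
    Qℕ = extend q (q F.zero)
    sℕ : ℕ → Carrier
    sℕ = extend stepAt 1#

    Qℕ-inject₁ : ∀ (j : Fin n) → Qℕ (toℕ j) ≡ q (F.inject₁ j)
    Qℕ-inject₁ j = Eq.trans (Eq.cong Qℕ (Eq.sym (FP.toℕ-inject₁ j))) (extend-toℕ q _ (F.inject₁ j))

    Qℕ-suc : ∀ (j : Fin n) → Qℕ (suc (toℕ j)) ≡ q (F.suc j)
    Qℕ-suc j = extend-toℕ q _ (F.suc j)

    Qℕ-last : Qℕ n ≡ q (F.fromℕ n)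
    Qℕ-last = Eq.trans (Eq.cong Qℕ (Eq.sym (FP.toℕ-fromℕ n))) (extend-toℕ q _ (F.fromℕ n))

    nestingℕ : IsNestingℕ n Nℕ
    nestingℕ = isNesting-fromFin nesting

    stepWeightsℕ : StepWeights n Nℕ Lℕ Qℕ sℕ
    stepWeightsℕ = record { atReturn = ret ; atCall = call ; atInternal = int }
      where
        open IsNesting nesting using (uniqueCall)
        ret : ∀ i j → Nℕ i j ≡ true → sℕ j ≈ δret (Qℕ j) (Qℕ i) (Lℕ j) (Qℕ (suc j))
        ret i j e with extend₂-inv ν i j e
        ... | a , b , refl , refl , v with stepKind b
        ...   | callStep none _ _ _ = ⊥-elim (true≢false (Eq.trans (Eq.sym v) (none a)))
        ...   | internalStep none _ _ = ⊥-elim (true≢false (Eq.trans (Eq.sym v) (none a)))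
        ...   | returnStep a′ v′ eq with uniqueCall a′ a b v′ v
        ...     | refl rewrite extend-toℕ stepAt 1# b | Qℕ-inject₁ b | Qℕ-inject₁ a | extend-toℕ letter firstLetter b
                         | Qℕ-suc b = ≈-reflexive eq
        call : ∀ j c → (∀ i → Nℕ i j ≡ false) → Nℕ j c ≡ true → sℕ j ≈ δcall (Qℕ j) (Lℕ j) (Qℕ (suc j))
        call j c none e with extend₂-inv ν j c e
        ... | a , b , refl , refl , v with stepKind a
        ...   | returnStep a′ v′ _ = ⊥-elim (true≢false (Eq.trans (Eq.sym (Eq.trans (extend₂-toℕ ν a′ a) v′)) (none (toℕ a′))))
        ...   | internalStep _ noRet _ = ⊥-elim (true≢false (Eq.trans (Eq.sym v) (noRet b)))
        ...   | callStep _ _ _ eq rewrite extend-toℕ stepAt 1# a | Qℕ-inject₁ a | extend-toℕ letter firstLetter a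
                                   | Qℕ-suc a = ≈-reflexive eq
        int : ∀ j → j < n → (∀ i → Nℕ i j ≡ false) → (∀ c → Nℕ j c ≡ false) → sℕ j ≈ δint (Qℕ j) (Lℕ j) (Qℕ (suc j))
        int j j<n none noRet with F.fromℕ< j<n | FP.toℕ-fromℕ< j<n
        ... | a | refl with stepKind a
        ...   | returnStep a′ v′ _ = ⊥-elim (true≢false (Eq.trans (Eq.sym (Eq.trans (extend₂-toℕ ν a′ a) v′)) (none (toℕ a′))))
        ...   | callStep _ b v _ = ⊥-elim (true≢false (Eq.trans (Eq.sym (Eq.trans (extend₂-toℕ ν a b) v)) (noRet (toℕ b))))
        ...   | internalStep _ _ eq rewrite extend-toℕ stepAt 1# a | Qℕ-inject₁ a | extend-toℕ letter firstLetter a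
                                     | Qℕ-suc a = ≈-reflexive eq

    open Parse nestingℕ stepWeightsℕ

    runTree : Σ (RunTree (q F.zero) (Qℕ n)) λ t → (runWeight K A w q ≈ weight t) × NonEmpty t
    runTree with parse n 0 n z≤n ℕP.≤-refl ℕP.≤-refl (λ i j e → (λ _ _ → proj₂ (IsNestingℕ.range nestingℕ i j e)) , (λ _ _ → z≤n))
    ... | t , eq , ne = t , ≈-trans (∏-extend stepAt 1#) eq , ne nonempty

  -- The word, nesting relation and run states described by a run tree, on
  -- ℕ-positions; x is a default letter for positions beyond the word.
  treeSize : ∀ {p r} → RunTree p r → ℕ
  treeSize done                       = 0
  treeSize (internal a p′ t)          = suc (treeSize t)
  treeSize (block a p₁ p₂ t₁ b p₃ t₂) = suc (treeSize t₁ + suc (treeSize t₂))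

  prepend : ∀ {a} {X : Set a} → X → (ℕ → X) → ℕ → X
  prepend x f zero    = x
  prepend x f (suc m) = f m

  lettersOf : Fin d → ∀ {p r} → RunTree p r → ℕ → Fin d
  lettersOf x done                       = λ _ → x
  lettersOf x (internal a p′ t)          = prepend a (lettersOf x t)
  lettersOf x (block a p₁ p₂ t₁ b p₃ t₂) = prepend a (glue (treeSize t₁) (lettersOf x t₁) (prepend b (lettersOf x t₂)))

  statesOf : ∀ {p r} → RunTree p r → ℕ → Fin k
  statesOf {p} done                       = λ _ → p
  statesOf {p} (internal a p′ t)          = prepend p (statesOf t)
  statesOf {p} (block a p₁ p₂ t₁ b p₃ t₂) = prepend p (glue (suc (treeSize t₁)) (statesOf t₁) (statesOf t₂))

  nestingOf : ∀ {p r} → RunTree p r → ℕ → ℕ → Bool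
  nestingOf done                       = λ _ _ → false
  nestingOf (internal a p′ t)          = shiftRel (nestingOf t)
  nestingOf (block a p₁ p₂ t₁ b p₃ t₂) = callBlock (treeSize t₁) (nestingOf t₁) (nestingOf t₂)

  statesOf-first : ∀ {p r} (t : RunTree p r) → statesOf t 0 ≡ p
  statesOf-first done                       = refl
  statesOf-first (internal a p′ t)          = refl
  statesOf-first (block a p₁ p₂ t₁ b p₃ t₂) = refl

  statesOf-last : ∀ {p r} (t : RunTree p r) → statesOf t (treeSize t) ≡ r
  statesOf-last done              = refl
  statesOf-last (internal a p′ t) = statesOf-last t
  statesOf-last (block a p₁ p₂ t₁ b p₃ t₂) =
    Eq.trans (Eq.cong (glue (suc (treeSize t₁)) (statesOf t₁) (statesOf t₂)) (ℕP.+-suc (treeSize t₁) (treeSize t₂)))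
      (Eq.trans (glue-right (suc (treeSize t₁)) (statesOf t₁) (statesOf t₂) (treeSize t₂)) (statesOf-last t₂))

  nestingOf-isNesting : ∀ {p r} (t : RunTree p r) → IsNestingℕ (treeSize t) (nestingOf t)
  nestingOf-isNesting done = record
    { range = λ _ _ () ; uniqueRet = λ _ _ _ () ; uniqueCall = λ _ _ _ () ; noCross = λ _ _ _ _ () }
  nestingOf-isNesting (internal a p′ t)          = shiftRel-nesting (nestingOf-isNesting t)
  nestingOf-isNesting (block a p₁ p₂ t₁ b p₃ t₂) = callBlock-nesting (nestingOf-isNesting t₁) (nestingOf-isNesting t₂)

  δint-cong : ∀ {p p′ a a′ q q′} → p ≡ p′ → a ≡ a′ → q ≡ q′ → δint p a q ≡ δint p′ a′ q′
  δint-cong refl refl refl = refl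

  δcall-cong : ∀ {p p′ a a′ q q′} → p ≡ p′ → a ≡ a′ → q ≡ q′ → δcall p a q ≡ δcall p′ a′ q′
  δcall-cong refl refl refl = refl

  δret-cong : ∀ {p p′ o o′ a a′ q q′} → p ≡ p′ → o ≡ o′ → a ≡ a′ → q ≡ q′ → δret p o a q ≡ δret p′ o′ a′ q′
  δret-cong refl refl refl refl = refl

  StepWeights-tail : ∀ {n N L Q s a p} → StepWeights (suc n) (shiftRel N) (prepend a L) (prepend p Q) s →
                     StepWeights n N L Q (λ m → s (suc m))
  StepWeights-tail sw = record
    { atReturn   = λ i j e → atReturn (suc i) (suc j) e
    ; atCall     = λ j c none e → atCall (suc j) (suc c) (λ { zero → refl ; (suc i) → none i }) e
    ; atInternal = λ j h none noRet → atInternal (suc j) (s≤s h) (λ { zero → refl ; (suc i) → none i })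
                                                                  (λ { zero → refl ; (suc c) → noRet c }) }
    where open StepWeights sw

  module _ {s₁ s₂ N₁ N₂ L₁ L₂ Q₁ Q₂ s a b p}
           (sw : StepWeights (suc (s₁ + suc s₂)) (callBlock s₁ N₁ N₂) (prepend a (glue s₁ L₁ (prepend b L₂)))
                             (prepend p (glue (suc s₁) Q₁ Q₂)) s) where
    open StepWeights sw
    open CallBlockPositions s₁ N₁ N₂
    private
      Q = prepend p (glue (suc s₁) Q₁ Q₂)
      L = prepend a (glue s₁ L₁ (prepend b L₂))

    StepWeights-inner : IsNestingℕ s₁ N₁ → StepWeights s₁ N₁ L₁ Q₁ (λ m → s (suc m))
    StepWeights-inner nest₁ = record { atReturn = ret ; atCall = call ; atInternal = int }
      where
        open IsNestingℕ nest₁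
        Q-in : ∀ j → j ≤ s₁ → Q (suc j) ≡ Q₁ j
        Q-in j h = glue-left (suc s₁) Q₁ Q₂ j (s≤s h)
        L-in : ∀ j → j < s₁ → L (suc j) ≡ L₁ j
        L-in j h = glue-left s₁ L₁ (prepend b L₂) j h
        ret : ∀ i j → N₁ i j ≡ true → s (suc j) ≈ δret (Q₁ j) (Q₁ i) (L₁ j) (Q₁ (suc j))
        ret i j e =
          let i<j = proj₁ (range i j e) ; j<s = proj₂ (range i j e) ; i<s = ℕP.<-trans i<j j<s in
          ≈-trans (atReturn (suc i) (suc j) (Eq.trans (blockDiag-ll s₁ N₁ (shiftRel N₂) i j i<s j<s) e))
                  (≈-reflexive (δret-cong (Q-in j (ℕP.<⇒≤ j<s)) (Q-in i (ℕP.<⇒≤ i<s)) (L-in j j<s) (Q-in (suc j) j<s)))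
        call : ∀ j c → (∀ i → N₁ i j ≡ false) → N₁ j c ≡ true → s (suc j) ≈ δcall (Q₁ j) (L₁ j) (Q₁ (suc j))
        call j c none e =
          let j<c = proj₁ (range j c e) ; c<s = proj₂ (range j c e) ; j<s = ℕP.<-trans j<c c<s in
          ≈-trans (atCall (suc j) (suc c) (notReturn-inner j j<s none) (Eq.trans (blockDiag-ll s₁ N₁ (shiftRel N₂) j c j<s c<s) e))
                  (≈-reflexive (δcall-cong (Q-in j (ℕP.<⇒≤ j<s)) (L-in j j<s) (Q-in (suc j) j<s)))
        int : ∀ j → j < s₁ → (∀ i → N₁ i j ≡ false) → (∀ c → N₁ j c ≡ false) →
              s (suc j) ≈ δint (Q₁ j) (L₁ j) (Q₁ (suc j))
        int j h none noRet =
          ≈-trans (atInternal (suc j) (s≤s (ℕP.<-≤-trans h (ℕP.m≤m+n s₁ _))) (notReturn-inner j h none) (notCall-inner j h noRet))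
                  (≈-reflexive (δint-cong (Q-in j (ℕP.<⇒≤ h)) (L-in j h) (Q-in (suc j) h)))

    StepWeights-outer : StepWeights s₂ N₂ L₂ Q₂ (λ m → s (suc (s₁ + suc m)))
    StepWeights-outer = record { atReturn = ret ; atCall = call ; atInternal = int }
      where
        Q-out : ∀ j → Q (suc (s₁ + suc j)) ≡ Q₂ j
        Q-out j = Eq.trans (Eq.cong (glue (suc s₁) Q₁ Q₂) (ℕP.+-suc s₁ j)) (glue-right (suc s₁) Q₁ Q₂ j)
        Q-out′ : ∀ j → Q (suc (suc (s₁ + suc j))) ≡ Q₂ (suc j)
        Q-out′ j = Eq.trans (Eq.cong (λ m → Q (suc m)) (Eq.sym (ℕP.+-suc s₁ (suc j)))) (Q-out (suc j))
        L-out : ∀ j → L (suc (s₁ + suc j)) ≡ L₂ j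
        L-out j = glue-right s₁ L₁ (prepend b L₂) (suc j)
        ret : ∀ i j → N₂ i j ≡ true → s (suc (s₁ + suc j)) ≈ δret (Q₂ j) (Q₂ i) (L₂ j) (Q₂ (suc j))
        ret i j e = ≈-trans (atReturn _ _ (Eq.trans (blockDiag-rr s₁ N₁ (shiftRel N₂) (suc i) (suc j)) e))
                            (≈-reflexive (δret-cong (Q-out j) (Q-out i) (L-out j) (Q-out′ j)))
        call : ∀ j c → (∀ i → N₂ i j ≡ false) → N₂ j c ≡ true → s (suc (s₁ + suc j)) ≈ δcall (Q₂ j) (L₂ j) (Q₂ (suc j))
        call j c none e =
          ≈-trans (atCall _ (suc (s₁ + suc c)) (notReturn-outer j none) (Eq.trans (blockDiag-rr s₁ N₁ (shiftRel N₂) (suc j) (suc c)) e))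
                  (≈-reflexive (δcall-cong (Q-out j) (L-out j) (Q-out′ j)))
        int : ∀ j → j < s₂ → (∀ i → N₂ i j ≡ false) → (∀ c → N₂ j c ≡ false) →
              s (suc (s₁ + suc j)) ≈ δint (Q₂ j) (L₂ j) (Q₂ (suc j))
        int j h none noRet =
          ≈-trans (atInternal _ (s≤s (ℕP.+-monoʳ-< s₁ (s≤s h))) (notReturn-outer j none) (notCall-outer j noRet))
                  (≈-reflexive (δint-cong (Q-out j) (L-out j) (Q-out′ j)))

  weight-fromSteps : ∀ {p r} (t : RunTree p r) x s →
                     StepWeights (treeSize t) (nestingOf t) (lettersOf x t) (statesOf t) s → ∏ℕ s 0 (treeSize t) ≈ weight t
  weight-fromSteps done x s sw = ≈-refl
  weight-fromSteps {p} (internal a p′ t) x s sw = *-cong first rest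
    where
      open StepWeights sw
      first : s 0 ≈ δint p a p′
      first = ≈-trans (atInternal 0 (s≤s z≤n) (λ { zero → refl ; (suc i) → refl }) (λ c → refl))
                      (≈-reflexive (Eq.cong (δint p a) (statesOf-first t)))
      rest : ∏ℕ s 1 (treeSize t) ≈ weight t
      rest = ≈-trans (≈-reflexive (∏ℕ-shift s 0 (treeSize t))) (weight-fromSteps t x _ (StepWeights-tail sw))
  weight-fromSteps {p} (block a p₁ p₂ t₁ b p₃ t₂) x s sw = begin
    s 0 * ∏ℕ s 1 (s₁ + suc s₂)                            ≈⟨ *-congˡ (∏ℕ-split s 1 s₁ (suc s₂)) ⟩
    s 0 * (∏ℕ s 1 s₁ * (s (suc s₁) * ∏ℕ s (suc (suc s₁)) s₂)) ≈⟨ *-cong call (*-cong inner (*-cong ret outer)) ⟩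
    δcall p a p₁ * (weight t₁ * (δret p₂ p b p₃ * weight t₂))  ∎
    where
      open StepWeights sw
      s₁ = treeSize t₁
      s₂ = treeSize t₂
      call : s 0 ≈ δcall p a p₁
      call = ≈-trans (atCall 0 (suc s₁) (λ { zero → refl ; (suc i) → refl }) (≡ᵇ-refl s₁))
                     (≈-reflexive (Eq.cong (δcall p a) (statesOf-first t₁)))
      ret : s (suc s₁) ≈ δret p₂ p b p₃
      ret = ≈-trans (atReturn 0 (suc s₁) (≡ᵇ-refl s₁))
        (≈-reflexive (δret-cong (Eq.trans (glue-left (suc s₁) (statesOf t₁) (statesOf t₂) s₁ ℕP.≤-refl) (statesOf-last t₁))
                                refl
                                (glue-right₀ s₁ (lettersOf x t₁) (prepend b (lettersOf x t₂)))
                                (Eq.trans (glue-right₀ (suc s₁) (statesOf t₁) (statesOf t₂)) (statesOf-first t₂))))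
      inner : ∏ℕ s 1 s₁ ≈ weight t₁
      inner = ≈-trans (≈-reflexive (∏ℕ-shift s 0 s₁))
                      (weight-fromSteps t₁ x _ (StepWeights-inner sw (nestingOf-isNesting t₁)))
      outer : ∏ℕ s (suc (suc s₁)) s₂ ≈ weight t₂
      outer = ≈-trans (≈-reflexive (Eq.trans (∏ℕ-offset s (suc (suc s₁)) s₂)
                                    (∏ℕ-cong _ _ 0 s₂ (λ m → Eq.cong s (Eq.cong suc (Eq.sym (ℕP.+-suc s₁ m)))))))
                      (weight-fromSteps t₂ x _ (StepWeights-outer sw))

  StepWeights-transport : ∀ {n N N′ L L′ Q Q′ s} → IsNestingℕ n N′ → StepWeights n N L Q s →
                          (∀ i j → N i j ≡ N′ i j) → (∀ m → m < n → L m ≡ L′ m) → (∀ m → m ≤ n → Q m ≡ Q′ m) →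
                          StepWeights n N′ L′ Q′ s
  StepWeights-transport {n} {N} {N′} {L} {L′} {Q} {Q′} {s} nest sw N≗ L≗ Q≗ =
    record { atReturn = ret ; atCall = call ; atInternal = int }
    where
      open StepWeights sw
      open IsNestingℕ nest
      ret : ∀ i j → N′ i j ≡ true → s j ≈ δret (Q′ j) (Q′ i) (L′ j) (Q′ (suc j))
      ret i j e = let i<j = proj₁ (range i j e) ; j<n = proj₂ (range i j e) in
        ≈-trans (atReturn i j (Eq.trans (N≗ i j) e))
          (≈-reflexive (δret-cong (Q≗ j (ℕP.<⇒≤ j<n)) (Q≗ i (ℕP.<⇒≤ (ℕP.<-trans i<j j<n))) (L≗ j j<n) (Q≗ (suc j) j<n)))
      call : ∀ j c → (∀ i → N′ i j ≡ false) → N′ j c ≡ true → s j ≈ δcall (Q′ j) (L′ j) (Q′ (suc j))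
      call j c none e = let j<n = ℕP.<-trans (proj₁ (range j c e)) (proj₂ (range j c e)) in
        ≈-trans (atCall j c (λ i → Eq.trans (N≗ i j) (none i)) (Eq.trans (N≗ j c) e))
          (≈-reflexive (δcall-cong (Q≗ j (ℕP.<⇒≤ j<n)) (L≗ j j<n) (Q≗ (suc j) j<n)))
      int : ∀ j → j < n → (∀ i → N′ i j ≡ false) → (∀ c → N′ j c ≡ false) → s j ≈ δint (Q′ j) (L′ j) (Q′ (suc j))
      int j j<n none noRet =
        ≈-trans (atInternal j j<n (λ i → Eq.trans (N≗ i j) (none i)) (λ c → Eq.trans (N≗ j c) (noRet c)))
          (≈-reflexive (δint-cong (Q≗ j (ℕP.<⇒≤ j<n)) (L≗ j j<n) (Q≗ (suc j) j<n)))

  firstLetterOf : ∀ {p r} (t : RunTree p r) → NonEmpty t → Fin d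
  firstLetterOf (internal a p′ t)          _ = a
  firstLetterOf (block a p₁ p₂ t₁ b p₃ t₂) _ = a

  treeSize-nonempty : ∀ {p r} (t : RunTree p r) → NonEmpty t → 1 ≤ treeSize t
  treeSize-nonempty (internal a p′ t)          _ = s≤s z≤n
  treeSize-nonempty (block a p₁ p₂ t₁ b p₃ t₂) _ = s≤s z≤n

  wordOf : ∀ {p r} (t : RunTree p r) → NonEmpty t → NestedWord d
  wordOf t ne = record
    { n        = treeSize t
    ; nonempty = treeSize-nonempty t ne
    ; letter   = λ i → lettersOf (firstLetterOf t ne) t (toℕ i)
    ; ν        = λ i j → nestingOf t (toℕ i) (toℕ j)
    ; nesting  = isNesting-toFin (nestingOf-isNesting t) }

  runWeight-wordOf : ∀ {p r} (t : RunTree p r) (ne : NonEmpty t) (g : Fin (suc (treeSize t)) → Fin k) →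
                     (∀ i → g i ≡ statesOf t (toℕ i)) → runWeight K A (wordOf t ne) g ≈ weight t
  runWeight-wordOf t ne g g≗ =
    ≈-trans (∏-extend stepAt 1#)
      (weight-fromSteps t x sℕ (StepWeights-transport (nestingOf-isNesting t) stepWeightsℕ N≗ L≗ Q≗))
    where
      x = firstLetterOf t ne
      open FinRun (wordOf t ne) g
      N≗ : ∀ i j → Nℕ i j ≡ nestingOf t i j
      N≗ = extend₂-toFin (nestingOf-isNesting t)
      L≗ : ∀ m → m < treeSize t → Lℕ m ≡ lettersOf x t m
      L≗ m h = extend-agree _ _ (lettersOf x t) (λ i → refl) m h
      Q≗ : ∀ m → m ≤ treeSize t → Qℕ m ≡ statesOf t m
      Q≗ m h = extend-agree g _ (statesOf t) g≗ m (s≤s h)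

module Emptiness {c ℓ} (K : CommutativeSemiring c ℓ) (_≟_ : Decidable (CommutativeSemiring._≈_ K))
                 (zsf : ZeroSumFree K) {d k : ℕ} (A : WNWA K d k) where
  open CommutativeSemiring K
    using (Carrier; _≈_; _*_; 0#; *-cong; *-congˡ; *-commutativeSemigroup; semiring)
    renaming (sym to ≈-sym; trans to ≈-trans; reflexive to ≈-reflexive)
  open import Algebra.Properties.CommutativeSemigroup.Divisibility *-commutativeSemigroup using (_∣_; ∙-cong-∣)
  open import Algebra.Properties.Semiring.Divisibility semiring using (∣ʳ-refl; x∣y∧y≉0⇒x≉0)
  open WNWA A
  open SemiringFacts K
  open Runs K A

  labels : List Label
  labels = cartesianProduct (allFin k) (allFin k)

  labelsIn-labels : ∀ {p r} (t : RunTree p r) → LabelsIn labels t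
  labelsIn-labels {p} {r} done = ∈-cartesianProduct⁺ (∈-allFin p) (∈-allFin r)
  labelsIn-labels {p} {r} (internal a p′ t) = ∈-cartesianProduct⁺ (∈-allFin p) (∈-allFin r) , labelsIn-labels t
  labelsIn-labels {p} {r} (block a p₁ p₂ t₁ b p₃ t₂) =
    ∈-cartesianProduct⁺ (∈-allFin p) (∈-allFin r) , labelsIn-labels t₁ , labelsIn-labels t₂

  Candidate : Set
  Candidate = Σ (Fin k) λ p → Σ (Fin k) λ r → RunTree p r

  candidatesFor : ∀ p r → List (RunTree p r)
  candidatesFor p r = internals (length labels) p r ++ blocks (length labels) p r

  asCandidate : ∀ {p r} → RunTree p r → Candidate
  asCandidate t = _ , _ , t

  candidates : List Candidate
  candidates = forEach (allFin k) λ p → forEach (allFin k) λ r → map asCandidate (candidatesFor p r)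

  pumpToCandidate : ∀ {p r} (t : RunTree p r) → NonEmpty t →
                    Σ (RunTree p r) λ t′ → t′ ∈ candidatesFor p r × NonEmpty t′ × weight t′ ∣ weight t
  pumpToCandidate (internal a p′ u) _ with pump (length labels) labels ℕP.≤-refl u (labelsIn-labels u)
  ... | u′ , h , dv =
    internal a p′ u′ , ∈-++⁺ˡ (internals-complete (length labels) a p′ u′ h) , tt , internal-mono∣ a p′ u u′ dv
  pumpToCandidate {p} {r} (block a p₁ p₂ t₁ b p₃ t₂) _
    with pump (length labels) labels ℕP.≤-refl t₁ (labelsIn-labels t₁)
       | pump (length labels) labels ℕP.≤-refl t₂ (labelsIn-labels t₂)
  ... | t₁′ , h₁ , dv₁ | t₂′ , h₂ , dv₂ =
    block a p₁ p₂ t₁′ b p₃ t₂′ ,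
    ∈-++⁺ʳ (internals (length labels) p r) (blocks-complete (length labels) a p₁ p₂ t₁′ b p₃ t₂′ h₁ h₂) , tt ,
    block-mono∣ a p₁ p₂ t₁ t₁′ b p₃ t₂ t₂′ dv₁ dv₂

  ∈-candidates : ∀ {p r} {t : RunTree p r} → t ∈ candidatesFor p r → asCandidate t ∈ candidates
  ∈-candidates {p} {r} m = ∈-forEach (∈-allFin p) (∈-forEach (∈-allFin r) (∈-map⁺ _ m))

  runTerm : (w : NestedWord d) → (Fin (suc (NestedWord.n w)) → Fin k) → Carrier
  runTerm w g = ι (g F.zero) * runWeight K A w g * κ (g (F.fromℕ (NestedWord.n w)))

  Witness : Candidate → Set ℓ
  Witness (p , r , t) = NonEmpty t × ¬ (ι p * weight t * κ r ≈ 0#)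

  nonEmpty? : ∀ {p r} (t : RunTree p r) → Dec (NonEmpty t)
  nonEmpty? done                       = no (λ ())
  nonEmpty? (internal a p′ t)          = yes tt
  nonEmpty? (block a p₁ p₂ t₁ b p₃ t₂) = yes tt

  witness? : ∀ x → Dec (Witness x)
  witness? (p , r , t) = nonEmpty? t ×-dec ¬? ((ι p * weight t * κ r) ≟ 0#)

  -- Soundness: the word of a witness has a nonzero value.  By zero-sum
  -- freeness its run through the states of the tree would have a zero term.
  witness⇒notAllZero : ∀ {x} → Witness x → ¬ (∀ w → ⟦_⟧ K A w ≈ 0#)
  witness⇒notAllZero {p , r , t} (ne , nz) allZero
    with ∑seq-zero⁻¹ zsf (suc (treeSize t)) _ (allZero (wordOf t ne)) (λ i → statesOf t (toℕ i))
  ... | g , g≗ , z = nz (≈-trans (≈-sym term≈) z)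
    where
      first : g F.zero ≡ p
      first = Eq.trans (g≗ F.zero) (statesOf-first t)
      last : g (F.fromℕ (treeSize t)) ≡ r
      last = Eq.trans (g≗ _) (Eq.trans (Eq.cong (statesOf t) (FP.toℕ-fromℕ (treeSize t))) (statesOf-last t))
      term≈ : runTerm (wordOf t ne) g ≈ ι p * weight t * κ r
      term≈ = *-cong (*-cong (≈-reflexive (Eq.cong ι first)) (runWeight-wordOf t ne g g≗)) (≈-reflexive (Eq.cong κ last))

  -- Completeness: a run with a nonzero term yields a witness, by describing
  -- the run by a run tree and pumping it down to a candidate.
  nonzeroRun⇒witness : ∀ w g → ¬ (runTerm w g ≈ 0#) → Any Witness candidates
  nonzeroRun⇒witness w g nz with FinRun.runTree w g
  ... | t , w≈ , ne with pumpToCandidate t ne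
  ...   | t′ , m , ne′ , dv = lose (∈-candidates m) (ne′ , x∣y∧y≉0⇒x≉0 dv′ nz′)
    where
      last = FinRun.Qℕ w g (NestedWord.n w)
      dv′ : ι (g F.zero) * weight t′ * κ last ∣ ι (g F.zero) * weight t * κ last
      dv′ = ∙-cong-∣ (∙-cong-∣ ∣ʳ-refl dv) ∣ʳ-refl
      nz′ : ¬ (ι (g F.zero) * weight t * κ last ≈ 0#)
      nz′ z = nz (≈-trans (*-cong (*-congˡ w≈) (≈-reflexive (Eq.cong κ (Eq.sym (FinRun.Qℕ-last w g))))) z)

  noWitness⇒allZero : ¬ Any Witness candidates → ∀ w → ⟦_⟧ K A w ≈ 0#
  noWitness⇒allZero none w =
    ∑seq-zero (suc (NestedWord.n w)) (runTerm w) λ g →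
      decidable-stable (runTerm w g ≟ 0#) (λ nz → none (nonzeroRun⇒witness w g nz))

  allZero⇒noWitness : (∀ w → ⟦_⟧ K A w ≈ 0#) → ¬ Any Witness candidates
  allZero⇒noWitness allZero witnesses = witness⇒notAllZero (proj₂ (satisfied witnesses)) allZero

-- The series vanishes iff no candidate is a witness, and the latter is decided
-- by testing the finitely many candidates.
corollary5p11 : ∀ {c ℓ} (K : CommutativeSemiring c ℓ) →
    Decidable (CommutativeSemiring._≈_ K) →
    ¬ (CommutativeSemiring._≈_ K (CommutativeSemiring.0# K) (CommutativeSemiring.1# K)) →
    ZeroSumFree K →
    (d k : ℕ) (A : WNWA K d k) →
    Dec (∀ (w : NestedWord d) → CommutativeSemiring._≈_ K (⟦_⟧ K A w) (CommutativeSemiring.0# K))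
corollary5p11 K _≟_ _ zsf d k A =
  map′ noWitness⇒allZero allZero⇒noWitness (¬? (any? witness? candidates))
  where open Emptiness K _≟_ zsf A
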